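{- Let $k\geq 2$ be an integer. If $G$ is a cactus of order $n\ge 1$, then $\alpha_k(G)\geq \left\lfloor\dfrac{k}{k+1}\,n\right\rfloor+1$.
   Context: All graphs are finite and simple. A cactus is a graph in which every block is a cycle, a single edge, or a single vertex (not necessarily connected). A set $S$ of vertices is $k$-sparse if the subgraph induced by $S$ has maximum degree at most $k$; $\alpha_k(G)$ is the maximum size of a $k$-sparse set of $G$. -}

module Defs where

open import Data.Nat using (ℕ; zero; suc; _≤_; _≥_; _+_; _*_)
open import Data.Nat.DivMod using (_/_)
open import Data.Bool using (Bool; true; false; _∧_)
open import Data.Fin using (Fin)
open import Data.Fin.Subset using (Subset; _∈_; _∉_; _⊆_; ∣_∣; _-_)
open import Data.Vec using (tabulate; lookup)
open import Data.Product using (Σ; _×_; ∃)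
open import Data.Sum using (_⊎_)
open import Relation.Binary.PropositionalEquality using (_≡_; _≢_)
open import Relation.Nullary using (¬_)

record Graph (n : ℕ) : Set where
  field
    adj     : Fin n → Fin n → Bool
    adj-sym : ∀ u v → adj u v ≡ adj v u
    irrefl  : ∀ v → adj v v ≡ false
open Graph public

module _ {n : ℕ} (G : Graph n) where

  nbrsIn : Subset n → Fin n → Subset n
  nbrsIn S v = tabulate (λ w → adj G v w ∧ lookup S w)

  degIn : Subset n → Fin n → ℕ
  degIn S v = ∣ nbrsIn S v ∣

  Sparse : ℕ → Subset n → Set
  Sparse k S = ∀ v → v ∈ S → degIn S v ≤ k

  data Walk (S : Subset n) : Fin n → Fin n → Set where
    here : ∀ {u} → u ∈ S → Walk S u u
    step : ∀ {u w v} → u ∈ S → adj G u w ≡ true → Walk S w v → Walk S u v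

  -- G[S] is connected (the empty graph counts as connected)
  Connected : Subset n → Set
  Connected S = ∀ u v → u ∈ S → v ∈ S → Walk S u v

  Nonseparable : Subset n → Set
  Nonseparable B =
    (∃ λ v → v ∈ B) × Connected B × (∀ v → v ∈ B → Connected (B - v))

  Block : Subset n → Set
  Block B = Nonseparable B × (∀ C → B ⊆ C → Nonseparable C → C ⊆ B)

  IsCycle : Subset n → Set
  IsCycle B = 3 ≤ ∣ B ∣ × Connected B × (∀ v → v ∈ B → degIn B v ≡ 2)

  IsEdge : Subset n → Set
  IsEdge B = ∃ λ u → ∃ λ v → u ∈ B × v ∈ B × adj G u v ≡ true × ∣ B ∣ ≡ 2

  IsVertex : Subset n → Set
  IsVertex B = ∣ B ∣ ≡ 1

  Cactus : Set
  Cactus = ∀ B → Block B → IsCycle B ⊎ IsEdge B ⊎ IsVertex B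

αk≥ : {n : ℕ} → Graph n → ℕ → ℕ → Set
αk≥ {n} G k m = Σ (Subset n) λ S → Sparse G k S × m ≤ ∣ S ∣

module Submission where

open import Defs
open import Data.Nat using (ℕ; _≤_; _+_; _*_; suc)
open import Data.Nat.DivMod using (_/_)

import Data.Nat as ℕ
open import Data.Nat using (zero; _<_; _∸_; z≤n; s≤s; s≤s⁻¹; _<?_; _≤?_)
open import Data.Nat.Properties hiding (_≟_)
open import Data.Nat.DivMod using (m<n*o⇒m/o<n)
import Data.Bool as Bool
open import Data.Bool using (Bool; true; false; _∧_; _∨_; not; if_then_else_)
open import Data.Bool.Properties using (∧-identityʳ; ∧-zeroʳ; ∨-zeroʳ)
open import Data.Fin using (Fin; zero; suc; fromℕ<)
open import Data.Fin.Properties using (_≟_; any?; all?)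
open import Data.Fin.Subset using (Subset; ∣_∣) renaming (_∈_ to _∈ₛ_; _-_ to _-ₛ_; _⊆_ to _⊆ₛ_)
import Data.Fin.Subset as Subset
open import Data.Fin.Subset.Properties
  using (_∈?_; _⊆?_; nonempty?; anySubset?; p⊂q⇒∣p∣<∣q∣; ∣p∣≤n; x∈p∧x≢y⇒x∈p-y; p─q⊆p; p─q─q≡p─q; x∈p⇒∣p-x∣<∣p∣)
open import Data.Vec using (tabulate; lookup)
open import Data.Vec.Properties using (lookup∘tabulate; tabulate∘lookup; []=⇒lookup; lookup⇒[]=)
open import Data.Product using (∃; _×_; _,_; proj₁; proj₂)
open import Data.Sum using (_⊎_; inj₁; inj₂; [_,_]′; swap)
open import Data.Empty using (⊥; ⊥-elim)
open import Relation.Nullary using (yes; no; Dec; does)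
open import Relation.Nullary.Decidable using (dec-true; dec-false; _×-dec_; _→-dec_; ¬?; decidable-stable)
open import Relation.Binary.PropositionalEquality

-- We prove a stronger statement by induction on |U|: for every vertex set U and capacities
-- c : V → ℕ there is D ⊆ U such that every vertex v of U ∖ D has at most c(v) neighbours in
-- U ∖ D, and (k+1)|D| is at most, and for nonempty U less than, the potential
-- Σ_{u ∈ U} (1 + (k − c(u))). For U = V and c ≡ k the potential is n, so V ∖ D is a k-sparse
-- set with more than kn/(k+1) vertices.
--
-- In the induction step some vertex h exceeds its capacity. If U is disconnected we treat the
-- component of h and the rest separately; a vertex of capacity 0 with a neighbour is deleted.
-- Otherwise we find a branch P at a vertex w such that no vertex of P separates w from the rest
-- of U, i.e. P ∪ {w} is an end block. As G is a cactus, the vertices of P have degree at most 2.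
-- We then remove P (deleting w or lowering its capacity), or, around a vertex h ∈ P of capacity
-- 1 and degree 2, delete one vertex and set aside one or two others; in each case the potential
-- released pays for the deleted vertices.

∧-true⁻ : ∀ {a b} → a ∧ b ≡ true → a ≡ true × b ≡ true
∧-true⁻ {true} {true} _ = refl , refl

∧-true⁺ : ∀ {a b} → a ≡ true → b ≡ true → a ∧ b ≡ true
∧-true⁺ refl refl = refl

∨-true⁻ : ∀ {a b} → a ∨ b ≡ true → a ≡ true ⊎ b ≡ true
∨-true⁻ {true} _ = inj₁ refl
∨-true⁻ {false} e = inj₂ e

∨-trueˡ : ∀ {a} b → a ≡ true → a ∨ b ≡ true
∨-trueˡ _ refl = refl

∨-trueʳ : ∀ a {b} → b ≡ true → a ∨ b ≡ true
∨-trueʳ true _ = refl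
∨-trueʳ false e = e

∨-false⁻ : ∀ {a b} → a ∨ b ≡ false → a ≡ false × b ≡ false
∨-false⁻ {false} {false} _ = refl , refl

∨-false⁺ : ∀ {a b} → a ≡ false → b ≡ false → a ∨ b ≡ false
∨-false⁺ refl refl = refl

not-true⁻ : ∀ {a} → not a ≡ true → a ≡ false
not-true⁻ {false} _ = refl

not-true⁺ : ∀ {a} → a ≡ false → not a ≡ true
not-true⁺ refl = refl

true≢false : true ≢ false
true≢false ()

-- Vertex sets are Boolean predicates on Fin n; the vector subsets of Defs appear only at the interface.
Sub : ℕ → Set
Sub n = Fin n → Bool

module _ {n : ℕ} where

  infixr 7 _∩_
  infixr 6 _∪_
  infixl 6 _─_
  infixl 8 _∖_
  infix 4 _⊆_

  ∅ : Sub n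
  ∅ _ = false

  full : Sub n
  full _ = true

  ⁅_⁆ : Fin n → Sub n
  ⁅ x ⁆ i = does (i ≟ x)

  _∩_ _∪_ _─_ : Sub n → Sub n → Sub n
  (S ∩ T) i = S i ∧ T i
  (S ∪ T) i = S i ∨ T i
  (S ─ T) i = S i ∧ not (T i)

  _∖_ : Sub n → Fin n → Sub n
  S ∖ x = S ─ ⁅ x ⁆

  _⊆_ : Sub n → Sub n → Set
  S ⊆ T = ∀ i → S i ≡ true → T i ≡ true

∑ : ∀ {n} → (Fin n → ℕ) → ℕ
∑ {zero} f = 0
∑ {suc n} f = f zero + ∑ (λ i → f (suc i))

∑-cong : ∀ {n} {f g : Fin n → ℕ} → (∀ i → f i ≡ g i) → ∑ f ≡ ∑ g
∑-cong {zero} e = refl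
∑-cong {suc n} e = cong₂ _+_ (e zero) (∑-cong (λ i → e (suc i)))

∑-mono : ∀ {n} {f g : Fin n → ℕ} → (∀ i → f i ≤ g i) → ∑ f ≤ ∑ g
∑-mono {zero} e = z≤n
∑-mono {suc n} e = +-mono-≤ (e zero) (∑-mono (λ i → e (suc i)))

∑-distrib-+ : ∀ {n} (f g : Fin n → ℕ) → ∑ (λ i → f i + g i) ≡ ∑ f + ∑ g
∑-distrib-+ {zero} f g = refl
∑-distrib-+ {suc n} f g
  rewrite ∑-distrib-+ (λ i → f (suc i)) (λ i → g (suc i)) = interchange (f zero) (g zero) _ _
  where open import Algebra.Properties.CommutativeSemigroup +-commutativeSemigroup using (interchange)

∑-zero : ∀ n → ∑ {n} (λ _ → 0) ≡ 0
∑-zero zero = refl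
∑-zero (suc n) = ∑-zero n

∑-⁅⁆ : ∀ {n} (x : Fin n) (f : Fin n → ℕ) → ∑ (λ i → if ⁅ x ⁆ i then f i else 0) ≡ f x
∑-⁅⁆ {suc n} zero f = trans (cong (f zero +_) (∑-zero n)) (+-identityʳ (f zero))
∑-⁅⁆ {suc n} (suc x) f = ∑-⁅⁆ x (λ i → f (suc i))

term≤∑ : ∀ {n} (f : Fin n → ℕ) x → f x ≤ ∑ f
term≤∑ f zero = m≤m+n _ _
term≤∑ f (suc x) = ≤-trans (term≤∑ (λ i → f (suc i)) x) (m≤n+m _ _)

weight : ∀ {n} → (Fin n → ℕ) → Sub n → ℕ
weight w S = ∑ (λ i → if S i then w i else 0)

count : ∀ {n} → Sub n → ℕ
count = weight (λ _ → 1)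

any : ∀ {n} → Sub n → Bool
any {zero} S = false
any {suc n} S = S zero ∨ any (λ i → S (suc i))

module _ {n : ℕ} where

  x∈⁅x⁆ : ∀ (x : Fin n) → ⁅ x ⁆ x ≡ true
  x∈⁅x⁆ x = dec-true (x ≟ x) refl

  ≡⇒∈⁅⁆ : ∀ {i x : Fin n} → i ≡ x → ⁅ x ⁆ i ≡ true
  ≡⇒∈⁅⁆ {i} refl = x∈⁅x⁆ i

  ∉⁅⁆ : ∀ {i x : Fin n} → i ≢ x → ⁅ x ⁆ i ≡ false
  ∉⁅⁆ {i} {x} = dec-false (i ≟ x)

  ∈⁅⁆⇒≡ : ∀ {i x : Fin n} → ⁅ x ⁆ i ≡ true → i ≡ x
  ∈⁅⁆⇒≡ {i} {x} e with i ≟ x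
  ... | yes i≡x = i≡x

  ∉⁅⁆⇒≢ : ∀ {i x : Fin n} → ⁅ x ⁆ i ≡ false → i ≢ x
  ∉⁅⁆⇒≢ {x = x} e refl = true≢false (trans (sym (x∈⁅x⁆ x)) e)

  ∪-⊆ : ∀ {S T V : Sub n} → S ⊆ V → T ⊆ V → S ∪ T ⊆ V
  ∪-⊆ {S} S⊆V T⊆V i e with ∨-true⁻ {S i} e
  ... | inj₁ Si = S⊆V i Si
  ... | inj₂ Ti = T⊆V i Ti

  separated⇒disjoint : ∀ {D₁ D₂ S : Sub n} → D₁ ⊆ S → (∀ i → D₂ i ≡ true → S i ≡ false) → ∀ i → D₁ i ∧ D₂ i ≡ false
  separated⇒disjoint {D₁} {D₂} D₁⊆S D₂∩S=∅ i with D₁ i in e₁ | D₂ i in e₂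
  ... | false | _ = refl
  ... | true | false = refl
  ... | true | true = ⊥-elim (true≢false (trans (sym (D₁⊆S i e₁)) (D₂∩S=∅ i e₂)))

  ⁅⁆-disjoint : ∀ {x y : Fin n} → x ≢ y → ∀ i → ⁅ x ⁆ i ∧ ⁅ y ⁆ i ≡ false
  ⁅⁆-disjoint {x} x≢y i with ⁅ x ⁆ i in e
  ... | false = refl
  ... | true = ∉⁅⁆ {i} (λ i≡y → x≢y (trans (sym (∈⁅⁆⇒≡ {i} e)) i≡y))

  ⁅⁆⊆ : ∀ {S : Sub n} {x} → S x ≡ true → ⁅ x ⁆ ⊆ S
  ⁅⁆⊆ {S} Sx i e = subst (λ j → S j ≡ true) (sym (∈⁅⁆⇒≡ e)) Sx

  ∖-true⁻ : ∀ (S : Sub n) x {i} → (S ∖ x) i ≡ true → S i ≡ true × i ≢ x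
  ∖-true⁻ S x e with ∧-true⁻ e
  ... | Si , i≢x = Si , ∉⁅⁆⇒≢ (not-true⁻ i≢x)

  ∖-true⁺ : ∀ (S : Sub n) x {i} → S i ≡ true → i ≢ x → (S ∖ x) i ≡ true
  ∖-true⁺ S x Si i≢x = ∧-true⁺ Si (not-true⁺ (∉⁅⁆ i≢x))

  ∖-⊆ : ∀ (S : Sub n) x → S ∖ x ⊆ S
  ∖-⊆ S x i e = proj₁ (∖-true⁻ S x e)

  ─-⊆ : ∀ (S T : Sub n) → S ─ T ⊆ S
  ─-⊆ S T i e = proj₁ (∧-true⁻ e)


  module _ {w : Fin n → ℕ} where

    weight-mono : ∀ {S T : Sub n} → S ⊆ T → weight w S ≤ weight w T
    weight-mono {S} {T} S⊆T = ∑-mono (λ i → term-mono (S⊆T i))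
      where
      term-mono : ∀ {a b m} → (a ≡ true → b ≡ true) → (if a then m else 0) ≤ (if b then m else 0)
      term-mono {false} h = z≤n
      term-mono {true} h rewrite h refl = ≤-refl

    weight-cong : ∀ {S T : Sub n} → (∀ i → S i ≡ T i) → weight w S ≡ weight w T
    weight-cong S≗T = ∑-cong (λ i → cong (λ b → if b then w i else 0) (S≗T i))

    weight-none : ∀ {S : Sub n} → (∀ x → S x ≡ false) → weight w S ≡ 0
    weight-none none = trans (weight-cong none) (∑-zero n)

    weight-⁅⁆ : ∀ x → weight w ⁅ x ⁆ ≡ w x
    weight-⁅⁆ x = ∑-⁅⁆ x w

    ∈⇒≤weight : ∀ (S : Sub n) {x} → S x ≡ true → w x ≤ weight w S
    ∈⇒≤weight S {x} Sx =
      ≤-trans (≤-reflexive (cong (λ b → if b then w x else 0) (sym Sx))) (term≤∑ (λ i → if S i then w i else 0) x)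

    weight-∩-─ : ∀ (S T : Sub n) → weight w S ≡ weight w (S ∩ T) + weight w (S ─ T)
    weight-∩-─ S T = trans (∑-cong (λ i → split (S i) (T i)))
      (∑-distrib-+ (λ i → if S i ∧ T i then w i else 0) (λ i → if S i ∧ not (T i) then w i else 0))
      where
      split : ∀ {m} a b → (if a then m else 0) ≡ (if a ∧ b then m else 0) + (if a ∧ not b then m else 0)
      split false b = refl
      split true false = refl
      split {m} true true = sym (+-identityʳ m)

    weight-∪ : ∀ (S T : Sub n) → weight w (S ∪ T) ≤ weight w S + weight w T
    weight-∪ S T = ≤-trans (∑-mono (λ i → ∪-bound (S i) (T i)))
      (≤-reflexive (∑-distrib-+ (λ i → if S i then w i else 0) (λ i → if T i then w i else 0)))
      where
      ∪-bound : ∀ {m} a b → (if a ∨ b then m else 0) ≤ (if a then m else 0) + (if b then m else 0)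
      ∪-bound {m} true b = m≤m+n m _
      ∪-bound false b = ≤-refl

    weight-disjoint-∪ : ∀ (S T : Sub n) → (∀ i → S i ∧ T i ≡ false) → weight w (S ∪ T) ≡ weight w S + weight w T
    weight-disjoint-∪ S T disjoint = trans (∑-cong (λ i → disjoint-sum (S i) (T i) (disjoint i)))
      (∑-distrib-+ (λ i → if S i then w i else 0) (λ i → if T i then w i else 0))
      where
      disjoint-sum : ∀ {m} a b → a ∧ b ≡ false → (if a ∨ b then m else 0) ≡ (if a then m else 0) + (if b then m else 0)
      disjoint-sum {m} true false _ = sym (+-identityʳ m)
      disjoint-sum false b _ = refl

  count-full : count (full {n}) ≡ n
  count-full = go n
    where
    go : ∀ m → count {m} full ≡ m
    go zero = refl
    go (suc m) = cong suc (go m)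

  count-∅ : count (∅ {n}) ≡ 0
  count-∅ = weight-none {w = λ _ → 1} {S = ∅} (λ _ → refl)

  count≤n : ∀ (S : Sub n) → count S ≤ n
  count≤n S = ≤-trans (weight-mono {S = S} {T = full} (λ _ _ → refl)) (≤-reflexive count-full)

  ∈⇒1≤count : ∀ (S : Sub n) {x} → S x ≡ true → 1 ≤ count S
  ∈⇒1≤count = ∈⇒≤weight

  count-∖ : ∀ (S : Sub n) {x} → S x ≡ true → count S ≡ suc (count (S ∖ x))
  count-∖ S {x} Sx = begin
    count S                               ≡⟨ weight-∩-─ S ⁅ x ⁆ ⟩
    count (S ∩ ⁅ x ⁆) + count (S ∖ x)    ≡⟨ cong (_+ count (S ∖ x)) (trans (weight-cong at-x) (weight-⁅⁆ x)) ⟩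
    suc (count (S ∖ x))                   ∎
    where
    open ≡-Reasoning
    at-x : ∀ i → S i ∧ ⁅ x ⁆ i ≡ ⁅ x ⁆ i
    at-x i with ⁅ x ⁆ i in e
    ... | true = trans (∧-identityʳ (S i)) (trans (cong S (∈⁅⁆⇒≡ e)) Sx)
    ... | false = ∧-zeroʳ (S i)

  count-⊂ : ∀ {S T : Sub n} {x} → S ⊆ T → T x ≡ true → S x ≡ false → count S < count T
  count-⊂ {S} {T} {x} S⊆T Tx Sx = begin-strict
    count S                 ≤⟨ weight-mono S⊆T∖x ⟩
    count (T ∖ x)           <⟨ ≤-refl ⟩
    suc (count (T ∖ x))     ≡⟨ sym (count-∖ T Tx) ⟩
    count T                 ∎
    where
    open ≤-Reasoning
    S⊆T∖x : S ⊆ T ∖ x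
    S⊆T∖x i Si = ∖-true⁺ T x (S⊆T i Si) λ { refl → true≢false (trans (sym Si) Sx) }

  any-true⁺ : ∀ (S : Sub n) {x} → S x ≡ true → any S ≡ true
  any-true⁺ S {x} Sx = go S x Sx
    where
    go : ∀ {m} (S : Sub m) x → S x ≡ true → any S ≡ true
    go S zero Sx = ∨-trueˡ _ Sx
    go S (suc x) Sx = ∨-trueʳ (S zero) (go (λ i → S (suc i)) x Sx)

  any-true⁻ : ∀ (S : Sub n) → any S ≡ true → ∃ λ x → S x ≡ true
  any-true⁻ = go
    where
    go : ∀ {m} (S : Sub m) → any S ≡ true → ∃ λ x → S x ≡ true
    go {suc m} S e with ∨-true⁻ {S zero} e
    ... | inj₁ S0 = zero , S0
    ... | inj₂ rest with go (λ i → S (suc i)) rest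
    ... | x , Sx = suc x , Sx

  any-cong : ∀ {S T : Sub n} → (∀ i → S i ≡ T i) → any S ≡ any T
  any-cong = go
    where
    go : ∀ {m} {S T : Sub m} → (∀ i → S i ≡ T i) → any S ≡ any T
    go {zero} e = refl
    go {suc m} e = cong₂ _∨_ (e zero) (go (λ i → e (suc i)))

  inhabited? : ∀ (S : Sub n) → (∃ λ x → S x ≡ true) ⊎ (∀ x → S x ≡ false)
  inhabited? S with any S in e
  ... | true = inj₁ (any-true⁻ S e)
  ... | false = inj₂ none
    where
    none : ∀ x → S x ≡ false
    none x with S x in Sx
    ... | true = ⊥-elim (true≢false (trans (sym (any-true⁺ S Sx)) e))
    ... | false = refl

  1≤count⇒∃ : ∀ (S : Sub n) → 1 ≤ count S → ∃ λ x → S x ≡ true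
  1≤count⇒∃ S 1≤∣S∣ with inhabited? S
  ... | inj₁ found = found
  ... | inj₂ none = ⊥-elim (<⇒≱ 1≤∣S∣ (≤-reflexive (weight-none none)))

  count≤0⇒∉ : ∀ (S : Sub n) → count S ≤ 0 → ∀ x → S x ≡ false
  count≤0⇒∉ S ∣S∣≤0 x with S x in Sx
  ... | true = ⊥-elim (<⇒≱ (∈⇒1≤count S Sx) ∣S∣≤0)
  ... | false = refl

  ∉⇒count≤0 : ∀ (S : Sub n) → (∀ x → S x ≡ false) → count S ≤ 0
  ∉⇒count≤0 S none = ≤-reflexive (weight-none none)

  two-elements : ∀ (S : Sub n) → 2 ≤ count S → ∃ λ x → ∃ λ y → S x ≡ true × S y ≡ true × x ≢ y
  two-elements S 2≤∣S∣ with 1≤count⇒∃ S (≤-trans (s≤s z≤n) 2≤∣S∣)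
  ... | x , Sx with 1≤count⇒∃ (S ∖ x) (s≤s⁻¹ (≤-trans 2≤∣S∣ (≤-reflexive (count-∖ S Sx))))
  ... | y , S∖x∋y with ∖-true⁻ S x S∖x∋y
  ... | Sy , y≢x = x , y , Sx , Sy , λ x≡y → y≢x (sym x≡y)

  three-elements : ∀ (S : Sub n) → 3 ≤ count S →
    ∃ λ x → ∃ λ y → ∃ λ z → S x ≡ true × S y ≡ true × S z ≡ true × x ≢ y × x ≢ z × y ≢ z
  three-elements S 3≤∣S∣ with 1≤count⇒∃ S (≤-trans (s≤s z≤n) 3≤∣S∣)
  ... | x , Sx with two-elements (S ∖ x) (s≤s⁻¹ (≤-trans 3≤∣S∣ (≤-reflexive (count-∖ S Sx))))
  ... | y , z , S∖x∋y , S∖x∋z , y≢z with ∖-true⁻ S x S∖x∋y | ∖-true⁻ S x S∖x∋z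
  ... | Sy , y≢x | Sz , z≢x = x , y , z , Sx , Sy , Sz , (λ e → y≢x (sym e)) , (λ e → z≢x (sym e)) , y≢z

  three≤count : ∀ (S : Sub n) {x y z} → S x ≡ true → S y ≡ true → S z ≡ true →
    x ≢ y → x ≢ z → y ≢ z → 3 ≤ count S
  three≤count S {x} {y} {z} Sx Sy Sz x≢y x≢z y≢z = begin
    3                           ≤⟨ s≤s (s≤s (∈⇒1≤count (S ∖ x ∖ y) S∖x∖y∋z)) ⟩
    suc (suc (count (S ∖ x ∖ y))) ≡⟨ cong suc (sym (count-∖ (S ∖ x) S∖x∋y)) ⟩
    suc (count (S ∖ x))          ≡⟨ sym (count-∖ S Sx) ⟩
    count S                      ∎
    where
    open ≤-Reasoning
    S∖x∋y = ∖-true⁺ S x Sy (λ e → x≢y (sym e))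
    S∖x∖y∋z = ∖-true⁺ (S ∖ x) y (∖-true⁺ S x Sz (λ e → x≢z (sym e))) (λ e → y≢z (sym e))

  count≤2⇒only : ∀ (S : Sub n) {x y} → S x ≡ true → S y ≡ true → x ≢ y → count S ≤ 2 →
    ∀ z → S z ≡ true → z ≡ x ⊎ z ≡ y
  count≤2⇒only S {x} {y} Sx Sy x≢y ∣S∣≤2 z Sz with z ≟ x | z ≟ y
  ... | yes z≡x | _ = inj₁ z≡x
  ... | no _ | yes z≡y = inj₂ z≡y
  ... | no z≢x | no z≢y =
    ⊥-elim (<⇒≱ (s≤s ∣S∣≤2) (three≤count S Sx Sy Sz x≢y (λ e → z≢x (sym e)) (λ e → z≢y (sym e))))

  ⊆⇒≗⊎⊂ : ∀ {S T : Sub n} → S ⊆ T → (∀ i → T i ≡ S i) ⊎ (∃ λ i → T i ≡ true × S i ≡ false)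
  ⊆⇒≗⊎⊂ {S} {T} S⊆T with inhabited? (T ─ S)
  ... | inj₁ (i , T─S∋i) = inj₂ (i , proj₁ (∧-true⁻ T─S∋i) , not-true⁻ (proj₂ (∧-true⁻ T─S∋i)))
  ... | inj₂ none = inj₁ same
    where
    same : ∀ i → T i ≡ S i
    same i with S i in Si | T i in Ti
    ... | true | true = refl
    ... | false | false = refl
    ... | true | false = ⊥-elim (true≢false (trans (sym (S⊆T i Si)) Ti))
    ... | false | true = ⊥-elim (true≢false (trans (sym (cong₂ _∧_ Ti (cong not Si))) (none i)))

module Paths {n : ℕ} (G : Graph n) where

  A : Fin n → Fin n → Bool
  A = adj G

  adj⇒≢ : ∀ {u v} → A u v ≡ true → v ≢ u
  adj⇒≢ {u} uv refl = true≢false (trans (sym uv) (irrefl G u))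

  adj-flip : ∀ {u v} → A u v ≡ true → A v u ≡ true
  adj-flip {u} {v} uv = trans (adj-sym G v u) uv

  data Path (S : Sub n) : Fin n → Fin n → Set where
    here : ∀ {u} → S u ≡ true → Path S u u
    step : ∀ {u w v} → S u ≡ true → A u w ≡ true → Path S w v → Path S u v

  module _ {S : Sub n} where

    infixr 5 _++_

    source∈ : ∀ {u v} → Path S u v → S u ≡ true
    source∈ (here Su) = Su
    source∈ (step Su _ _) = Su

    target∈ : ∀ {u v} → Path S u v → S v ≡ true
    target∈ (here Sv) = Sv
    target∈ (step _ _ p) = target∈ p

    _++_ : ∀ {u w v} → Path S u w → Path S w v → Path S u v
    here _ ++ q = q
    step Su uw p ++ q = step Su uw (p ++ q)

    extend : ∀ {u w v} → Path S u w → A w v ≡ true → S v ≡ true → Path S u v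
    extend p wv Sv = p ++ step (target∈ p) wv (here Sv)

    reverse : ∀ {u v} → Path S u v → Path S v u
    reverse (here Su) = here Su
    reverse (step Su uw p) = extend (reverse p) (adj-flip uw) Su

  Linked : Sub n → Set
  Linked S = ∀ {a b} → S a ≡ true → S b ≡ true → Path S a b

  Path-mono : ∀ {S T} → S ⊆ T → ∀ {u v} → Path S u v → Path T u v
  Path-mono S⊆T (here Su) = here (S⊆T _ Su)
  Path-mono S⊆T (step Su uw p) = step (S⊆T _ Su) uw (Path-mono S⊆T p)

  Path-∩ : ∀ {S} T {u v} → Path S u v → (∀ y → Path S u y → T y ≡ true) → Path (S ∩ T) u v
  Path-∩ T (here Su) inT = here (∧-true⁺ Su (inT _ (here Su)))
  Path-∩ T (step Su uw p) inT =
    step (∧-true⁺ Su (inT _ (here Su))) uw (Path-∩ T p (λ y q → inT y (step Su uw q)))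

  split-at-first-arrival : ∀ {S z} x → Path S z x →
    z ≡ x ⊎ ∃ λ y → Path (S ∖ x) z y × A y x ≡ true
  split-at-first-arrival x (here _) = inj₁ refl
  split-at-first-arrival {S} {z} x (step Sz zw p) with z ≟ x
  ... | yes z≡x = inj₁ z≡x
  ... | no z≢x with split-at-first-arrival x p
  ... | inj₁ refl = inj₂ (z , here (∖-true⁺ S x Sz z≢x) , zw)
  ... | inj₂ (y , q , yx) = inj₂ (y , step (∖-true⁺ S x Sz z≢x) zw q , yx)

  split-at-last-departure : ∀ {S z} x → Path S x z →
    z ≡ x ⊎ ∃ λ y → A x y ≡ true × Path (S ∖ x) y z
  split-at-last-departure x p with split-at-first-arrival x (reverse p)
  ... | inj₁ z≡x = inj₁ z≡x
  ... | inj₂ (y , q , yx) = inj₂ (y , adj-flip yx , reverse q)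

  -- within t: the vertices reached from u inside S in at most t steps. Until it stabilises it
  -- gains a vertex at every step, so it is stable from t = n on.
  module Reachability (S : Sub n) (u : Fin n) where

    within : ℕ → Sub n
    within zero = S ∩ ⁅ u ⁆
    within (suc t) v = within t v ∨ (S v ∧ any (λ w → within t w ∧ A w v))

    within-sound : ∀ t {v} → within t v ≡ true → Path S u v
    within-sound zero {v} e with ∧-true⁻ {S v} e
    ... | Sv , v≡u = subst (λ w → Path S w v) (∈⁅⁆⇒≡ v≡u) (here Sv)
    within-sound (suc t) {v} e with within t v in old
    ... | true = within-sound t old
    ... | false with ∧-true⁻ {S v} e
    ... | Sv , some with any-true⁻ (λ w → within t w ∧ A w v) some
    ... | w , e′ with ∧-true⁻ {within t w} e′
    ... | w∈ , wv = extend (within-sound t w∈) wv Sv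

    within-grows : ∀ t → within t ⊆ within (suc t)
    within-grows t v e = ∨-trueˡ _ e

    Stable : ℕ → Set
    Stable t = ∀ v → within (suc t) v ≡ within t v

    stable-suc : ∀ t → Stable t → Stable (suc t)
    stable-suc t st v =
      cong₂ (λ a b → a ∨ (S v ∧ b)) (st v) (any-cong (λ w → cong (_∧ A w v) (st w)))

    stable-or-growing : S u ≡ true → ∀ t → Stable t ⊎ t + 2 ≤ count (within (suc t))
    stable-or-growing Su zero with ⊆⇒≗⊎⊂ (within-grows zero)
    ... | inj₁ st = inj₁ st
    ... | inj₂ (v , new , old) =
      inj₂ (≤-trans (s≤s (∈⇒1≤count (within zero) (∧-true⁺ Su (x∈⁅x⁆ u)))) (count-⊂ (within-grows zero) new old))
    stable-or-growing Su (suc t) with stable-or-growing Su t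
    ... | inj₁ st = inj₁ (stable-suc t st)
    ... | inj₂ grown with ⊆⇒≗⊎⊂ (within-grows (suc t))
    ... | inj₁ st = inj₁ st
    ... | inj₂ (v , new , old) = inj₂ (≤-trans (s≤s grown) (count-⊂ (within-grows (suc t)) new old))

    stable-at-n : S u ≡ true → Stable n
    stable-at-n Su with stable-or-growing Su n
    ... | inj₁ st = st
    ... | inj₂ n+2≤ = ⊥-elim (<⇒≱ (≤-trans (m<m+n n (s≤s z≤n)) n+2≤) (count≤n (within (suc n))))

    origin∈within : S u ≡ true → ∀ t → within t u ≡ true
    origin∈within Su zero = ∧-true⁺ Su (x∈⁅x⁆ u)
    origin∈within Su (suc t) = ∨-trueˡ _ (origin∈within Su t)

    within-n-closed : S u ≡ true → ∀ {w v} → within n w ≡ true → A w v ≡ true → S v ≡ true → within n v ≡ true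
    within-n-closed Su {w} {v} w∈ wv Sv = begin
      within n v                                         ≡⟨ sym (stable-at-n Su v) ⟩
      within n v ∨ (S v ∧ any (λ x → within n x ∧ A x v)) ≡⟨ cong (λ b → within n v ∨ (S v ∧ b)) some ⟩
      within n v ∨ (S v ∧ true)                          ≡⟨ cong (λ b → within n v ∨ b) (trans (∧-identityʳ (S v)) Sv) ⟩
      within n v ∨ true                                  ≡⟨ ∨-zeroʳ (within n v) ⟩
      true                                               ∎
      where
      open ≡-Reasoning
      some : any (λ x → within n x ∧ A x v) ≡ true
      some = any-true⁺ (λ x → within n x ∧ A x v) (∧-true⁺ w∈ wv)

    within-n-complete : ∀ {x y} → Path S x y → within n x ≡ true → within n y ≡ true
    within-n-complete (here _) x∈ = x∈
    within-n-complete (step Sx xw p) x∈ =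
      within-n-complete p (within-n-closed (source∈ (within-sound n x∈)) x∈ xw (source∈ p))

  reach : Sub n → Fin n → Sub n
  reach S u = Reachability.within S u n

  reach-sound : ∀ S u {v} → reach S u v ≡ true → Path S u v
  reach-sound S u = Reachability.within-sound S u n

  reach-complete : ∀ S u {v} → Path S u v → reach S u v ≡ true
  reach-complete S u p = Reachability.within-n-complete S u p (Reachability.origin∈within S u (source∈ p) n)

  reach-false : ∀ S u {v} → reach S u v ≡ false → Path S u v → ⊥
  reach-false S u e p = true≢false (trans (sym (reach-complete S u p)) e)

  reach-path : ∀ S u {v} → reach S u v ≡ true → Path (S ∩ reach S u) u v
  reach-path S u r = Path-∩ (reach S u) (reach-sound S u r) (λ _ p → reach-complete S u p)

-- If x ∈ p - x, removing x from p - x once more would make it smaller, but p ─ q ─ q ≡ p ─ q.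
x∈p-y⇒x≢y : ∀ {n} {p : Subset n} {x y} → x ∈ₛ p -ₛ y → x ≢ y
x∈p-y⇒x≢y {p = p} {y = y} x∈p-y refl = <-irrefl (cong ∣_∣ (p─q─q≡p─q p Subset.⁅ y ⁆)) (x∈p⇒∣p-x∣<∣p∣ x∈p-y)

∣tabulate∣≡count : ∀ {n} (S : Sub n) → ∣ tabulate S ∣ ≡ count S
∣tabulate∣≡count {zero} S = refl
∣tabulate∣≡count {suc n} S with S zero
... | true = cong suc (∣tabulate∣≡count (λ i → S (suc i)))
... | false = ∣tabulate∣≡count (λ i → S (suc i))

module Blocks {n : ℕ} (G : Graph n) where
  open Paths G

  walk⇒path : ∀ {S : Subset n} {a b} → Walk G S a b → Path (lookup S) a b
  walk⇒path (Walk.here a∈S) = here ([]=⇒lookup a∈S)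
  walk⇒path (Walk.step a∈S ab w) = step ([]=⇒lookup a∈S) ab (walk⇒path w)

  path⇒walk : ∀ {S : Subset n} {a b} → Path (lookup S) a b → Walk G S a b
  path⇒walk (here Sa) = Walk.here (lookup⇒[]= _ _ Sa)
  path⇒walk (step Sa ab p) = Walk.step (lookup⇒[]= _ _ Sa) ab (path⇒walk p)

  walk? : ∀ (S : Subset n) a b → Dec (Walk G S a b)
  walk? S a b with reach (lookup S) a b in e
  ... | true = yes (path⇒walk (reach-sound (lookup S) a e))
  ... | false = no (λ w → reach-false (lookup S) a e (walk⇒path w))

  connected? : ∀ (S : Subset n) → Dec (Connected G S)
  connected? S with all? (λ u → all? (λ v → (u ∈? S) →-dec ((v ∈? S) →-dec walk? S u v)))
  ... | yes linked = yes linked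
  ... | no unlinked = no (λ linked → unlinked linked)

  nonseparable? : ∀ (S : Subset n) → Dec (Nonseparable G S)
  nonseparable? S = nonempty? S ×-dec (connected? S ×-dec all? (λ v → (v ∈? S) →-dec connected? (S -ₛ v)))

  extend-to-block : ∀ (S : Subset n) → Nonseparable G S → ∃ λ B → S ⊆ₛ B × Block G B
  extend-to-block S = go (n ∸ ∣ S ∣) S ≤-refl
    where
    go : ∀ m (S : Subset n) → n ∸ ∣ S ∣ ≤ m → Nonseparable G S → ∃ λ B → S ⊆ₛ B × Block G B
    go m S gap nsS with anySubset? (λ C → (S ⊆? C) ×-dec (nonseparable? C ×-dec ¬? (C ⊆? S)))
    ... | no none = S , (λ x∈S → x∈S) , nsS , maximal
      where
      maximal : ∀ C → S ⊆ₛ C → Nonseparable G C → C ⊆ₛ S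
      maximal C S⊆C nsC with C ⊆? S
      ... | yes C⊆S = C⊆S
      ... | no C⊈S = ⊥-elim (none (C , S⊆C , nsC , C⊈S))
    ... | yes (C , S⊆C , nsC , C⊈S) with m | any? (λ x → (x ∈? C) ×-dec ¬? (x ∈? S))
    ...   | _ | no C⊆S = ⊥-elim (C⊈S (λ {x} x∈C → decidable-stable (x ∈? S) (λ x∉S → C⊆S (x , x∈C , x∉S))))
    ...   | zero | yes new = ⊥-elim (<⇒≱ ∣S∣<∣C∣ (≤-trans (∣p∣≤n C) (m∸n≡0⇒m≤n (n≤0⇒n≡0 gap))))
      where ∣S∣<∣C∣ = p⊂q⇒∣p∣<∣q∣ (S⊆C , new)
    ...   | suc m | yes new with go m C (s≤s⁻¹ (≤-trans (∸-monoʳ-< (p⊂q⇒∣p∣<∣q∣ (S⊆C , new)) (∣p∣≤n C)) gap)) nsC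
    ...     | B , C⊆B , blockB = B , (λ x∈S → C⊆B (S⊆C x∈S)) , blockB

  Unseparated : Sub n → Set
  Unseparated B = Linked B × (∀ u → B u ≡ true → Linked (B ∖ u))

  -- Starting from v and the component of x in G − v, we shrink B at cut vertices u ≠ v to the part
  -- v-side B u on the side of v. This keeps v, its neighbours x y z and the connectivity of B ∖ v,
  -- and ends with a 2-connected set, in whose block v has three neighbours.
  module LinkedNeighbours {v x y z : Fin n} (vx : A v x ≡ true) (vy : A v y ≡ true) (vz : A v z ≡ true) where

    record Invariant (B : Sub n) : Set where
      field
        v∈ : B v ≡ true
        x∈ : B x ≡ true
        y∈ : B y ≡ true
        z∈ : B z ≡ true
        linked : Linked (B ∖ v)

    v-side : Sub n → Fin n → Sub n
    v-side B u = ⁅ u ⁆ ∪ reach (B ∖ u) v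

    module Shrink {B : Sub n} (inv : Invariant B) {u : Fin n} (u∈B : B u ≡ true) (u≢v : u ≢ v) where
      open Invariant inv

      v∈B∖u : (B ∖ u) v ≡ true
      v∈B∖u = ∖-true⁺ B u v∈ (λ v≡u → u≢v (sym v≡u))

      v-side-⊆ : v-side B u ⊆ B
      v-side-⊆ i e with ∨-true⁻ {⁅ u ⁆ i} e
      ... | inj₁ i≡u = subst (λ j → B j ≡ true) (sym (∈⁅⁆⇒≡ i≡u)) u∈B
      ... | inj₂ reached = ∖-⊆ B u i (target∈ (reach-sound (B ∖ u) v reached))

      neighbour∈ : ∀ {w} → B w ≡ true → A v w ≡ true → v-side B u w ≡ true
      neighbour∈ {w} w∈B vw with w ≟ u
      ... | yes _ = refl
      ... | no w≢u = reach-complete (B ∖ u) v (step v∈B∖u vw (here (∖-true⁺ B u w∈B w≢u)))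

      u∈side∖v : (v-side B u ∖ v) u ≡ true
      u∈side∖v = ∖-true⁺ (v-side B u) v (∨-trueˡ _ (x∈⁅x⁆ u)) u≢v

      from-u : ∀ {p} → (v-side B u ∖ v) p ≡ true → Path (v-side B u ∖ v) u p
      from-u {p} p∈ with ∖-true⁻ (v-side B u) v p∈
      ... | p∈side , p≢v with ∨-true⁻ {⁅ u ⁆ p} p∈side
      ... | inj₁ p≡u = subst (Path (v-side B u ∖ v) u) (sym (∈⁅⁆⇒≡ p≡u)) (here u∈side∖v)
      ... | inj₂ p-reached with split-at-last-departure u (linked (∖-true⁺ B v u∈B u≢v) (∖-true⁺ B v (v-side-⊆ p p∈side) p≢v))
      ... | inj₁ p≡u = ⊥-elim (proj₂ (∖-true⁻ B u (target∈ (reach-sound (B ∖ u) v p-reached))) p≡u)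
      ... | inj₂ (w , uw , w⇝p) = step u∈side∖v uw (Path-mono into (Path-∩ (reach (B ∖ u) v) w⇝p reached))
        where
        B∖v∖u⊆B∖u : B ∖ v ∖ u ⊆ B ∖ u
        B∖v∖u⊆B∖u j e with ∖-true⁻ (B ∖ v) u e
        ... | j∈B∖v , j≢u = ∖-true⁺ B u (∖-⊆ B v j j∈B∖v) j≢u
        reached : ∀ q → Path (B ∖ v ∖ u) w q → reach (B ∖ u) v q ≡ true
        reached q w⇝q = reach-complete (B ∖ u) v
          (reach-sound (B ∖ u) v p-reached ++ Path-mono B∖v∖u⊆B∖u (reverse w⇝p) ++ Path-mono B∖v∖u⊆B∖u w⇝q)
        into : B ∖ v ∖ u ∩ reach (B ∖ u) v ⊆ v-side B u ∖ v
        into j e with ∧-true⁻ {(B ∖ v ∖ u) j} e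
        ... | j∈ , r = ∖-true⁺ (v-side B u) v (∨-trueʳ (⁅ u ⁆ j) r) (proj₂ (∖-true⁻ B v (proj₁ (∖-true⁻ (B ∖ v) u j∈))))

      shrunk : Invariant (v-side B u)
      shrunk = record
        { v∈ = ∨-trueʳ (⁅ u ⁆ v) (reach-complete (B ∖ u) v (here v∈B∖u))
        ; x∈ = neighbour∈ x∈ vx
        ; y∈ = neighbour∈ y∈ vy
        ; z∈ = neighbour∈ z∈ vz
        ; linked = λ a∈ b∈ → reverse (from-u a∈) ++ from-u b∈
        }

    separating : Sub n → Sub n
    separating B u = (B ∖ v) u ∧ any ((B ∖ u) ─ reach (B ∖ u) v)

    unseparated : ∀ {B} → Invariant B → (∀ u → separating B u ≡ false) → Unseparated B
    unseparated {B} inv no-cut = (λ a∈ b∈ → reverse (from-v a∈) ++ from-v b∈) , linked-without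
      where
      open Invariant inv

      from-v : ∀ {a} → B a ≡ true → Path B v a
      from-v {a} a∈ with a ≟ v
      ... | yes refl = here v∈
      ... | no a≢v = step v∈ vx (Path-mono (∖-⊆ B v) (linked (∖-true⁺ B v x∈ (adj⇒≢ vx)) (∖-true⁺ B v a∈ a≢v)))

      linked-without : ∀ u → B u ≡ true → Linked (B ∖ u)
      linked-without u u∈ with u ≟ v
      ... | yes refl = linked
      ... | no u≢v = λ a∈ b∈ → reverse (from-v∖u a∈) ++ from-v∖u b∈
        where
        from-v∖u : ∀ {a} → (B ∖ u) a ≡ true → Path (B ∖ u) v a
        from-v∖u {a} a∈ with reach (B ∖ u) v a in r
        ... | true = reach-sound (B ∖ u) v r
        ... | false = ⊥-elim (true≢false (trans (sym cut) (no-cut u)))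
          where
          cut : separating B u ≡ true
          cut = ∧-true⁺ (∖-true⁺ B v u∈ u≢v) (any-true⁺ ((B ∖ u) ─ reach (B ∖ u) v) (∧-true⁺ a∈ (not-true⁺ r)))

    descend : ∀ m B → count B ≤ m → Invariant B → ∃ λ B* → Invariant B* × Unseparated B*
    descend m B ∣B∣≤m inv with inhabited? (separating B)
    ... | inj₂ no-cut = B , inv , unseparated inv no-cut
    ... | inj₁ (u , cut) with ∧-true⁻ {(B ∖ v) u} cut
    ... | u∈B∖v , some with any-true⁻ ((B ∖ u) ─ reach (B ∖ u) v) some | ∖-true⁻ B v u∈B∖v
    ... | a , a-cut | u∈B , u≢v with m | ∧-true⁻ {(B ∖ u) a} a-cut
    ...   | zero | _ = ⊥-elim (<⇒≱ (∈⇒1≤count B u∈B) ∣B∣≤m)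
    ...   | suc m | a∈B∖u , unreached = descend m (v-side B u) (s≤s⁻¹ (≤-trans smaller ∣B∣≤m)) shrunk
      where
      open Shrink inv u∈B u≢v
      smaller : count (v-side B u) < count B
      smaller = count-⊂ v-side-⊆ (∖-⊆ B u a a∈B∖u)
        (∨-false⁺ (∉⁅⁆ (proj₂ (∖-true⁻ B u a∈B∖u))) (not-true⁻ unreached))

    unseparated-around : Path (full ∖ v) x y → Path (full ∖ v) x z → ∃ λ B → Invariant B × Unseparated B
    unseparated-around x⇝y x⇝z = descend n B₀ (count≤n B₀) inv₀
      where
      B₀ : Sub n
      B₀ = ⁅ v ⁆ ∪ reach (full ∖ v) x

      reached∈B₀ : ∀ {w} → Path (full ∖ v) x w → B₀ w ≡ true
      reached∈B₀ x⇝w = ∨-trueʳ _ (reach-complete (full ∖ v) x x⇝w)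

      from-x : ∀ {a} → (B₀ ∖ v) a ≡ true → Path (B₀ ∖ v) x a
      from-x {a} a∈ with ∖-true⁻ B₀ v a∈
      ... | a∈B₀ , a≢v with ∨-true⁻ {⁅ v ⁆ a} a∈B₀
      ... | inj₁ a≡v = ⊥-elim (a≢v (∈⁅⁆⇒≡ a≡v))
      ... | inj₂ r = Path-mono into (reach-path (full ∖ v) x r)
        where
        into : (full ∖ v) ∩ reach (full ∖ v) x ⊆ B₀ ∖ v
        into j e with ∧-true⁻ {(full ∖ v) j} e
        ... | j∈ , rj = ∖-true⁺ B₀ v (∨-trueʳ (⁅ v ⁆ j) rj) (proj₂ (∖-true⁻ full v j∈))

      inv₀ : Invariant B₀
      inv₀ = record
        { v∈ = ∨-trueˡ _ (x∈⁅x⁆ v)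
        ; x∈ = reached∈B₀ (here (source∈ x⇝y))
        ; y∈ = reached∈B₀ x⇝y
        ; z∈ = reached∈B₀ x⇝z
        ; linked = λ a∈ b∈ → reverse (from-x a∈) ++ from-x b∈
        }

  unseparated⇒nonseparable : ∀ {B v} → B v ≡ true → Unseparated B → Nonseparable G (tabulate B)
  unseparated⇒nonseparable {B} {v} v∈ (linked , linked-without) =
      (v , ⇒∈S v∈)
    , (λ a b a∈ b∈ → path⇒walk (Path-mono (λ j e → []=⇒lookup (⇒∈S e)) (linked (∈S⇒ a∈) (∈S⇒ b∈))))
    , (λ u u∈ a b a∈ b∈ → path⇒walk (Path-mono (into u) (linked-without u (∈S⇒ u∈) (from u a∈) (from u b∈))))
    where
    S = tabulate B

    ∈S⇒ : ∀ {i} → i ∈ₛ S → B i ≡ true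
    ∈S⇒ {i} i∈S = trans (sym (lookup∘tabulate B i)) ([]=⇒lookup i∈S)

    ⇒∈S : ∀ {i} → B i ≡ true → i ∈ₛ S
    ⇒∈S {i} e = lookup⇒[]= i S (trans (lookup∘tabulate B i) e)

    from : ∀ u {a} → a ∈ₛ S -ₛ u → (B ∖ u) a ≡ true
    from u a∈ = ∖-true⁺ B u (∈S⇒ (p─q⊆p S _ a∈)) (x∈p-y⇒x≢y a∈)

    into : ∀ u → B ∖ u ⊆ lookup (S -ₛ u)
    into u j e with ∖-true⁻ B u e
    ... | j∈ , j≢u = []=⇒lookup (x∈p∧x≢y⇒x∈p-y (⇒∈S j∈) j≢u)

  degIn≤∣∣ : ∀ B v → degIn G B v ≤ ∣ B ∣
  degIn≤∣∣ B v = begin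
    degIn G B v                          ≡⟨ ∣tabulate∣≡count (λ w → A v w ∧ lookup B w) ⟩
    count (λ w → A v w ∧ lookup B w)     ≤⟨ weight-mono (λ w e → proj₂ (∧-true⁻ {A v w} e)) ⟩
    count (lookup B)                     ≡⟨ ∣tabulate∣≡count (lookup B) ⟨
    ∣ tabulate (lookup B) ∣              ≡⟨ cong ∣_∣ (tabulate∘lookup B) ⟩
    ∣ B ∣                                ∎
    where open ≤-Reasoning

  cactus⇒block-degree≤2 : Cactus G → ∀ {B v} → Block G B → v ∈ₛ B → degIn G B v ≤ 2
  cactus⇒block-degree≤2 cactus {B} {v} block v∈B with cactus B block
  ... | inj₁ (_ , _ , deg≡2) = ≤-reflexive (deg≡2 v v∈B)
  ... | inj₂ (inj₁ (_ , _ , _ , _ , _ , ∣B∣≡2)) = ≤-trans (degIn≤∣∣ B v) (≤-reflexive ∣B∣≡2)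
  ... | inj₂ (inj₂ ∣B∣≡1) = ≤-trans (degIn≤∣∣ B v) (≤-trans (≤-reflexive ∣B∣≡1) (s≤s z≤n))

  cactus⇒no-linked-neighbours : Cactus G → ∀ {v x y z} → A v x ≡ true → A v y ≡ true → A v z ≡ true →
    x ≢ y → x ≢ z → y ≢ z → Path (full ∖ v) x y → Path (full ∖ v) x z → ⊥
  cactus⇒no-linked-neighbours cactus {v} {x} {y} {z} vx vy vz x≢y x≢z y≢z x⇝y x⇝z
    with LinkedNeighbours.unseparated-around vx vy vz x⇝y x⇝z
  ... | B , inv , unseparated with extend-to-block (tabulate B) (unseparated⇒nonseparable v∈ unseparated)
    where open LinkedNeighbours.Invariant inv
  ... | Bk , B⊆Bk , block = <⇒≱ 3≤deg (cactus⇒block-degree≤2 cactus block (B⊆Bk (in-B v∈)))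
    where
    open LinkedNeighbours.Invariant inv
    in-B : ∀ {i} → B i ≡ true → i ∈ₛ tabulate B
    in-B {i} e = lookup⇒[]= i (tabulate B) (trans (lookup∘tabulate B i) e)
    ∈Bk : ∀ {i} → B i ≡ true → lookup Bk i ≡ true
    ∈Bk e = []=⇒lookup (B⊆Bk (in-B e))
    3≤deg : 3 ≤ degIn G Bk v
    3≤deg = ≤-trans
      (three≤count (λ w → A v w ∧ lookup Bk w) (∧-true⁺ vx (∈Bk x∈)) (∧-true⁺ vy (∈Bk y∈)) (∧-true⁺ vz (∈Bk z∈)) x≢y x≢z y≢z)
      (≤-reflexive (sym (∣tabulate∣≡count (λ w → A v w ∧ lookup Bk w))))

m∸[n∸o]≤m∸n+o : ∀ m n o → m ∸ (n ∸ o) ≤ (m ∸ n) + o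
m∸[n∸o]≤m∸n+o m n o = m≤n+o⇒m∸n≤o m (n ∸ o) (begin
  m                        ≤⟨ m≤n+m∸n m n ⟩
  n + (m ∸ n)              ≤⟨ +-monoˡ-≤ (m ∸ n) (m≤n+m∸n n o) ⟩
  o + (n ∸ o) + (m ∸ n)    ≡⟨ cong (_+ (m ∸ n)) (+-comm o (n ∸ o)) ⟩
  (n ∸ o) + o + (m ∸ n)    ≡⟨ +-assoc (n ∸ o) o (m ∸ n) ⟩
  (n ∸ o) + (o + (m ∸ n))  ≡⟨ cong ((n ∸ o) +_) (+-comm o (m ∸ n)) ⟩
  (n ∸ o) + ((m ∸ n) + o)  ∎)
  where open ≤-Reasoning

module Deletions {n : ℕ} (G : Graph n) (k : ℕ) where
  open Paths G

  deg : Sub n → Fin n → ℕ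
  deg U v = count (λ j → A v j ∧ U j)

  deg-mono : ∀ {S T : Sub n} v → (∀ j → A v j ≡ true → S j ≡ true → T j ≡ true) → deg S v ≤ deg T v
  deg-mono v S⇒T = weight-mono (λ j e → let vj , Sj = ∧-true⁻ {A v j} e in ∧-true⁺ vj (S⇒T j vj Sj))

  deg≤count : ∀ {S : Sub n} T v → (∀ j → A v j ≡ true → S j ≡ true → T j ≡ true) → deg S v ≤ count T
  deg≤count T v S⇒T = weight-mono (λ j e → let vj , Sj = ∧-true⁻ {A v j} e in S⇒T j vj Sj)

  deg-⊆-∪ : ∀ {S : Sub n} T E v → (∀ j → A v j ≡ true → S j ≡ true → (T ∪ E) j ≡ true) → deg S v ≤ deg T v + deg E v
  deg-⊆-∪ {S} T E v S⇒T∪E = ≤-trans (weight-mono cover) (weight-∪ (λ j → A v j ∧ T j) (λ j → A v j ∧ E j))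
    where
    cover : (λ j → A v j ∧ S j) ⊆ (λ j → A v j ∧ T j) ∪ (λ j → A v j ∧ E j)
    cover j e with ∧-true⁻ {A v j} e
    ... | vj , Sj with ∨-true⁻ {T j} (S⇒T∪E j vj Sj)
    ... | inj₁ Tj = ∨-trueˡ _ (∧-true⁺ vj Tj)
    ... | inj₂ Ej = ∨-trueʳ (A v j ∧ T j) (∧-true⁺ vj Ej)

  -- Each vertex pays 1 for itself plus the capacity k − c(u) it has lost; with c ≡ k this is |U|.
  potential : Sub n → (Fin n → ℕ) → ℕ
  potential U c = weight (λ i → suc (k ∸ c i)) U

  potential-∅ : ∀ c → potential ∅ c ≡ 0
  potential-∅ c = weight-none {w = λ i → suc (k ∸ c i)} {S = ∅} (λ _ → refl)

  count≤potential : ∀ (U : Sub n) c → count U ≤ potential U c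
  count≤potential U c = ∑-mono (λ i → term (U i))
    where
    term : ∀ {m} b → (if b then 1 else 0) ≤ (if b then suc m else 0)
    term true = s≤s z≤n
    term false = z≤n

  record Deletion (U : Sub n) (c : Fin n → ℕ) : Set where
    field
      D : Sub n
      D⊆U : D ⊆ U
      within-capacity : ∀ v → U v ≡ true → D v ≡ false → deg (U ─ D) v ≤ c v
      cost : suc k * count D ≤ potential U c
      cost-strict : ∀ {x} → U x ≡ true → suc k * count D < potential U c

  no-deletion : ∀ {U c} → (∀ v → U v ≡ true → deg U v ≤ c v) → Deletion U c
  no-deletion {U} {c} within = record
    { D = ∅
    ; D⊆U = λ _ ()
    ; within-capacity = λ v Uv _ → ≤-trans (deg-mono v (λ j _ e → trans (sym (∧-identityʳ (U j))) e)) (within v Uv)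
    ; cost = ≤-trans (≤-reflexive nothing-paid) z≤n
    ; cost-strict = λ {x} Ux → ≤-trans (s≤s (≤-reflexive nothing-paid)) (≤-trans (s≤s z≤n) (∈⇒≤weight U Ux))
    }
    where
    nothing-paid : suc k * count (∅ {n}) ≡ 0
    nothing-paid = trans (cong (suc k *_) (count-∅ {n})) (*-zeroʳ (suc k))

  paid-for-∪ : ∀ (D₁ D₂ : Sub n) → (∀ i → D₁ i ∧ D₂ i ≡ false) →
    suc k * count (D₁ ∪ D₂) ≡ suc k * count D₁ + suc k * count D₂
  paid-for-∪ D₁ D₂ disjoint = trans (cong (suc k *_) (weight-disjoint-∪ D₁ D₂ disjoint)) (*-distribˡ-+ (suc k) (count D₁) (count D₂))

  module SplitAlong {U c} (C : Sub n) (C⊆U : C ⊆ U)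
    (closed : ∀ {i j} → C i ≡ true → A i j ≡ true → U j ≡ true → C j ≡ true)
    (del₁ : Deletion C c) (del₂ : Deletion (U ─ C) c) where

    module del₁ = Deletion del₁
    module del₂ = Deletion del₂
    D₁ = del₁.D
    D₂ = del₂.D

    D⊆U : D₁ ∪ D₂ ⊆ U
    D⊆U = ∪-⊆ (λ i e → C⊆U i (del₁.D⊆U i e)) (λ i e → ─-⊆ U C i (del₂.D⊆U i e))

    paid : suc k * count (D₁ ∪ D₂) ≡ suc k * count D₁ + suc k * count D₂
    paid = paid-for-∪ D₁ D₂ (separated⇒disjoint del₁.D⊆U (λ i e → not-true⁻ (proj₂ (∧-true⁻ {U i} (del₂.D⊆U i e)))))

    potential-split : potential C c + potential (U ─ C) c ≡ potential U c
    potential-split = sym (trans (weight-∩-─ U C) (cong (_+ potential (U ─ C) c) (weight-cong U∩C≗C)))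
      where
      U∩C≗C : ∀ i → U i ∧ C i ≡ C i
      U∩C≗C i with C i in Ci
      ... | true = trans (∧-identityʳ (U i)) (C⊆U i Ci)
      ... | false = ∧-zeroʳ (U i)

    cost : suc k * count (D₁ ∪ D₂) ≤ potential U c
    cost = ≤-trans (≤-reflexive paid) (≤-trans (+-mono-≤ del₁.cost del₂.cost) (≤-reflexive potential-split))

    cost-strict : ∀ {x} → U x ≡ true → suc k * count (D₁ ∪ D₂) < potential U c
    cost-strict {x} Ux = ≤-trans (s≤s (≤-reflexive paid)) (≤-trans one-side-strict (≤-reflexive potential-split))
      where
      one-side-strict : suc k * count D₁ + suc k * count D₂ < potential C c + potential (U ─ C) c
      one-side-strict with C x in Cx
      ... | true = +-mono-<-≤ (del₁.cost-strict Cx) del₂.cost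
      ... | false = +-mono-≤-< del₁.cost (del₂.cost-strict (∧-true⁺ Ux (not-true⁺ Cx)))

    inside : ∀ {v} → C v ≡ true → ∀ j → A v j ≡ true → (U ─ (D₁ ∪ D₂)) j ≡ true → (C ─ D₁) j ≡ true
    inside Cv j vj e with ∧-true⁻ {U j} e
    ... | Uj , j∉D = ∧-true⁺ (closed Cv vj Uj) (not-true⁺ (proj₁ (∨-false⁻ {D₁ j} (not-true⁻ j∉D))))

    outside : ∀ {v} → U v ≡ true → C v ≡ false → ∀ j → A v j ≡ true → (U ─ (D₁ ∪ D₂)) j ≡ true → ((U ─ C) ─ D₂) j ≡ true
    outside Uv Cv j vj e with ∧-true⁻ {U j} e | C j in Cj
    ... | _ | true = ⊥-elim (true≢false (trans (sym (closed Cj (adj-flip vj) Uv)) Cv))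
    ... | Uj , j∉D | false = ∧-true⁺ (∧-true⁺ Uj refl) (not-true⁺ (proj₂ (∨-false⁻ {D₁ j} (not-true⁻ j∉D))))

    within-capacity : ∀ v → U v ≡ true → (D₁ ∪ D₂) v ≡ false → deg (U ─ (D₁ ∪ D₂)) v ≤ c v
    within-capacity v Uv v∉D with ∨-false⁻ {D₁ v} v∉D | C v in Cv
    ... | v∉D₁ , _ | true = ≤-trans (deg-mono v (inside Cv)) (del₁.within-capacity v Cv v∉D₁)
    ... | _ , v∉D₂ | false = ≤-trans (deg-mono v (outside Uv Cv)) (del₂.within-capacity v (∧-true⁺ Uv (not-true⁺ Cv)) v∉D₂)

    deletion : Deletion U c
    deletion = record { D = D₁ ∪ D₂ ; D⊆U = D⊆U ; within-capacity = within-capacity ; cost = cost ; cost-strict = cost-strict }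

  lowered : (Fin n → ℕ) → Fin n → ℕ → Fin n → ℕ
  lowered c p t i = c i ∸ (if ⁅ p ⁆ i then t else 0)

  potential-lowered : ∀ U c p t → potential U (lowered c p t) ≤ potential U c + t
  potential-lowered U c p t = begin
    potential U (lowered c p t)                                     ≤⟨ ∑-mono term ⟩
    ∑ (λ i → (if U i then suc (k ∸ c i) else 0) + drop i)          ≡⟨ ∑-distrib-+ _ drop ⟩
    potential U c + ∑ drop                                          ≡⟨ cong (potential U c +_) (∑-⁅⁆ p (λ _ → t)) ⟩
    potential U c + t                                               ∎
    where
    open ≤-Reasoning
    drop : Fin n → ℕ
    drop i = if ⁅ p ⁆ i then t else 0
    term : ∀ i → (if U i then suc (k ∸ lowered c p t i) else 0) ≤ (if U i then suc (k ∸ c i) else 0) + drop i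
    term i with U i
    ... | true = s≤s (m∸[n∸o]≤m∸n+o k (c i) (drop i))
    ... | false = z≤n

  -- Delete Y and set X aside: its vertices are within capacity in U ∖ Y. Of the remaining
  -- vertices only p has neighbours in X, at most t of them, so the capacity of p drops by t.
  record Removal (U : Sub n) (c : Fin n → ℕ) : Set where
    field
      X Y : Sub n
      p : Fin n
      t : ℕ
      X⊆U : X ⊆ U
      Y⊆U : Y ⊆ U
      X∩Y=∅ : ∀ i → X i ∧ Y i ≡ false
      t≤c : t ≤ c p
      X-within-capacity : ∀ x → X x ≡ true → deg (U ─ Y) x ≤ c x
      X-attached-at-p : ∀ u → (U ─ (X ∪ Y)) u ≡ true → deg X u ≤ (if ⁅ p ⁆ u then t else 0)
      affordable : t + suc k * count Y ≤ potential X c + potential Y c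
      affordable-strictly : (∃ λ u → (U ─ (X ∪ Y)) u ≡ true) ⊎ suc k * count Y < potential X c + potential Y c

    rest : Sub n
    rest = U ─ (X ∪ Y)

    c′ : Fin n → ℕ
    c′ = lowered c p t

  module Remove {U c} (r : Removal U c) (del : Deletion (Removal.rest r) (Removal.c′ r)) where
    open Removal r
    module del = Deletion del
    D′ = del.D

    D⊆U : D′ ∪ Y ⊆ U
    D⊆U i e with ∨-true⁻ {D′ i} e
    ... | inj₁ i∈D′ = ─-⊆ U (X ∪ Y) i (del.D⊆U i i∈D′)
    ... | inj₂ i∈Y = Y⊆U i i∈Y

    Y∉rest : ∀ i → Y i ≡ true → rest i ≡ false
    Y∉rest i Yi rewrite Yi | ∨-zeroʳ (X i) = ∧-zeroʳ (U i)

    paid : suc k * count (D′ ∪ Y) ≡ suc k * count D′ + suc k * count Y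
    paid = paid-for-∪ D′ Y (separated⇒disjoint del.D⊆U Y∉rest)

    decomposition : potential U c ≡ potential rest c + (potential X c + potential Y c)
    decomposition = begin-equality
      potential U c                                        ≡⟨ weight-∩-─ U (X ∪ Y) ⟩
      potential (U ∩ (X ∪ Y)) c + potential rest c         ≡⟨ cong (_+ potential rest c) (weight-cong U∩X∪Y≗X∪Y) ⟩
      potential (X ∪ Y) c + potential rest c               ≡⟨ cong (_+ potential rest c) (weight-disjoint-∪ X Y X∩Y=∅) ⟩
      potential X c + potential Y c + potential rest c     ≡⟨ +-comm _ (potential rest c) ⟩
      potential rest c + (potential X c + potential Y c)   ∎
      where
      open ≤-Reasoning
      U∩X∪Y≗X∪Y : ∀ i → U i ∧ (X i ∨ Y i) ≡ X i ∨ Y i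
      U∩X∪Y≗X∪Y i with X i in Xi | Y i in Yi
      ... | true | _ = trans (∧-identityʳ (U i)) (X⊆U i Xi)
      ... | false | true = trans (∧-identityʳ (U i)) (Y⊆U i Yi)
      ... | false | false = ∧-zeroʳ (U i)

    bound : ∀ {a} → a ≤ potential rest c′ → a + suc k * count Y ≤ potential U c
    bound {a} a≤ = begin
      a + suc k * count Y                                  ≤⟨ +-monoˡ-≤ _ (≤-trans a≤ (potential-lowered rest c p t)) ⟩
      potential rest c + t + suc k * count Y               ≡⟨ +-assoc (potential rest c) t _ ⟩
      potential rest c + (t + suc k * count Y)             ≤⟨ +-monoʳ-≤ (potential rest c) affordable ⟩
      potential rest c + (potential X c + potential Y c)   ≡⟨ sym decomposition ⟩
      potential U c                                        ∎
      where open ≤-Reasoning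

    cost : suc k * count (D′ ∪ Y) ≤ potential U c
    cost = ≤-trans (≤-reflexive paid) (bound del.cost)

    cost-strict : ∀ {x} → U x ≡ true → suc k * count (D′ ∪ Y) < potential U c
    cost-strict _ with inhabited? rest | affordable-strictly
    ... | inj₁ (u , u∈rest) | _ = ≤-trans (s≤s (≤-reflexive paid)) (bound (del.cost-strict u∈rest))
    ... | inj₂ empty | inj₁ (u , u∈rest) = ⊥-elim (true≢false (trans (sym u∈rest) (empty u)))
    ... | inj₂ empty | inj₂ strictly = begin-strict
      suc k * count (D′ ∪ Y)                               ≡⟨ paid ⟩
      suc k * count D′ + suc k * count Y                   <⟨ +-mono-≤-< nothing-deleted strictly ⟩
      0 + (potential X c + potential Y c)                  ≤⟨ +-monoˡ-≤ (potential X c + potential Y c) (z≤n {potential rest c}) ⟩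
      potential rest c + (potential X c + potential Y c)   ≡⟨ sym decomposition ⟩
      potential U c                                        ∎
      where
      open ≤-Reasoning
      nothing-deleted : suc k * count D′ ≤ 0
      nothing-deleted = ≤-trans del.cost (≤-reflexive (weight-none empty))

    drop≤c : ∀ v → (if ⁅ p ⁆ v then t else 0) ≤ c v
    drop≤c v with ⁅ p ⁆ v in e
    ... | true = subst (λ w → t ≤ c w) (sym (∈⁅⁆⇒≡ e)) t≤c
    ... | false = z≤n

    within-capacity : ∀ v → U v ≡ true → (D′ ∪ Y) v ≡ false → deg (U ─ (D′ ∪ Y)) v ≤ c v
    within-capacity v Uv v∉D with ∨-false⁻ {D′ v} v∉D | X v in Xv
    ... | _ , v∉Y | true = ≤-trans (deg-mono v avoids-Y) (X-within-capacity v Xv)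
      where
      avoids-Y : ∀ j → A v j ≡ true → (U ─ (D′ ∪ Y)) j ≡ true → (U ─ Y) j ≡ true
      avoids-Y j _ e with ∧-true⁻ {U j} e
      ... | Uj , j∉D = ∧-true⁺ Uj (not-true⁺ (proj₂ (∨-false⁻ {D′ j} (not-true⁻ j∉D))))
    ... | v∉D′ , v∉Y | false = begin
      deg (U ─ (D′ ∪ Y)) v                                 ≤⟨ deg-⊆-∪ (rest ─ D′) X v cover ⟩
      deg (rest ─ D′) v + deg X v                          ≤⟨ +-mono-≤ (del.within-capacity v v∈rest v∉D′) (X-attached-at-p v v∈rest) ⟩
      c′ v + (if ⁅ p ⁆ v then t else 0)                    ≡⟨ m∸n+n≡m (drop≤c v) ⟩
      c v                                                  ∎
      where
      open ≤-Reasoning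
      v∈rest : rest v ≡ true
      v∈rest = ∧-true⁺ Uv (not-true⁺ (∨-false⁺ Xv v∉Y))
      cover : ∀ j → A v j ≡ true → (U ─ (D′ ∪ Y)) j ≡ true → ((rest ─ D′) ∪ X) j ≡ true
      cover j _ e with X j in Xj | ∧-true⁻ {U j} e
      ... | true | _ = ∨-zeroʳ _
      ... | false | Uj , j∉D with ∨-false⁻ {D′ j} (not-true⁻ j∉D)
      ... | j∉D′ , j∉Y = ∨-trueˡ _ (∧-true⁺ (∧-true⁺ Uj (not-true⁺ j∉Y)) (not-true⁺ j∉D′))

    deletion : Deletion U c
    deletion = record { D = D′ ∪ Y ; D⊆U = D⊆U ; within-capacity = within-capacity ; cost = cost ; cost-strict = cost-strict }

module CactusDeletions {n : ℕ} (G : Graph n) (k : ℕ) (2≤k : 2 ≤ k) (cactus : Cactus G) where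
  open Paths G
  open Deletions G k
  open Blocks G using (cactus⇒no-linked-neighbours)

  module Step {U : Sub n} {c : Fin n → ℕ} (IH : ∀ {U′} c′ → count U′ < count U → Deletion U′ c′) where

    by-removal : (r : Removal U c) → ∀ {x} → U x ≡ true → (Removal.X r ∪ Removal.Y r) x ≡ true → Deletion U c
    by-removal r {x} Ux x∈X∪Y = Remove.deletion r (IH (Removal.c′ r) (count-⊂ (─-⊆ U (X ∪ Y)) Ux x∉rest))
      where
      open Removal r
      x∉rest : rest x ≡ false
      x∉rest rewrite x∈X∪Y = ∧-zeroʳ (U x)

    delete-zero-capacity : ∀ {v} → U v ≡ true → c v ≡ 0 → 1 ≤ deg U v → Deletion U c
    delete-zero-capacity {v} Uv cv≡0 has-neighbour = by-removal removal Uv (x∈⁅x⁆ v)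
      where
      j = proj₁ (1≤count⇒∃ (λ j → A v j ∧ U j) has-neighbour)
      vj,Uj = ∧-true⁻ {A v j} (proj₂ (1≤count⇒∃ (λ j → A v j ∧ U j) has-neighbour))
      removal : Removal U c
      removal = record
        { X = ∅ ; Y = ⁅ v ⁆ ; p = v ; t = 0
        ; X⊆U = λ _ ()
        ; Y⊆U = ⁅⁆⊆ Uv
        ; X∩Y=∅ = λ _ → refl
        ; t≤c = z≤n
        ; X-within-capacity = λ _ ()
        ; X-attached-at-p = λ u _ → ≤-trans (∉⇒count≤0 _ (λ j → ∧-zeroʳ (A u j))) z≤n
        ; affordable = ≤-reflexive (begin-equality
            suc k * count ⁅ v ⁆                     ≡⟨ cong (suc k *_) (weight-⁅⁆ v) ⟩
            suc k * 1                               ≡⟨ *-identityʳ (suc k) ⟩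
            suc (k ∸ 0)                             ≡⟨ cong (λ m → suc (k ∸ m)) cv≡0 ⟨
            suc (k ∸ c v)                           ≡⟨ weight-⁅⁆ v ⟨
            potential ⁅ v ⁆ c                        ≡⟨ cong (_+ potential ⁅ v ⁆ c) (potential-∅ c) ⟨
            potential ∅ c + potential ⁅ v ⁆ c        ∎)
        ; affordable-strictly = inj₁ (j , ∧-true⁺ (proj₂ vj,Uj) (not-true⁺ (∉⁅⁆ (adj⇒≢ (proj₁ vj,Uj)))))
        }
        where open ≤-Reasoning

    split-off-component : ∀ {h x} → U h ≡ true → (U ─ reach U h) x ≡ true → Deletion U c
    split-off-component {h} {x} Uh x∈U─C = SplitAlong.deletion C (λ i e → target∈ (reach-sound U h e)) closed
      (IH c (count-⊂ {S = C} {T = U} (λ i e → target∈ (reach-sound U h e)) Ux (not-true⁻ x∉C)))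
      (IH c (count-⊂ (─-⊆ U C) Uh h∉U─C))
      where
      C = reach U h
      Ux = proj₁ (∧-true⁻ {U x} x∈U─C)
      x∉C = proj₂ (∧-true⁻ {U x} x∈U─C)
      closed : ∀ {i j} → C i ≡ true → A i j ≡ true → U j ≡ true → C j ≡ true
      closed Ci ij Uj = reach-complete U h (extend (reach-sound U h Ci) ij Uj)
      h∉U─C : (U ─ C) h ≡ false
      h∉U─C rewrite reach-complete U h (here Uh) = ∧-zeroʳ (U h)

    module Connected (linked : Linked U) (positive : ∀ {v} → U v ≡ true → 1 ≤ deg U v → 1 ≤ c v) where

      K : Fin n → Fin n → Sub n
      K w y = reach (U ∖ w) y

      -- Pendant w y: no vertex of the component K w y of y in U − w separates w from anything,
      -- so K w y ∪ {w} is an end block of U.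
      Pendant : Fin n → Fin n → Set
      Pendant w y = ∀ {x z} → K w y x ≡ true → (U ∖ x) z ≡ true → Path (U ∖ x) w z

      K⊆U∖w : ∀ w y → K w y ⊆ U ∖ w
      K⊆U∖w w y i e = target∈ (reach-sound (U ∖ w) y e)

      K-closed : ∀ {w y a b} → K w y a ≡ true → A a b ≡ true → (U ∖ w) b ≡ true → K w y b ≡ true
      K-closed {w} {y} a∈K ab b∈ = reach-complete (U ∖ w) y (extend (reach-sound (U ∖ w) y a∈K) ab b∈)

      K-shrinks : ∀ {w y x z} → U w ≡ true → K w y x ≡ true → reach (U ∖ x) w z ≡ false → K x z ⊆ K w y
      K-shrinks {w} {y} {x} {z} Uw x∈K unreached i i∈K′ with K w y i in i∈K
      ... | true = refl
      ... | false with split-at-first-arrival w (linked (∖-⊆ U x i (K⊆U∖w x z i i∈K′)) Uw)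
      ...   | inj₁ refl = ⊥-elim (reach-false (U ∖ x) w unreached (reverse z⇝i))
        where z⇝i = reach-sound (U ∖ x) z i∈K′
      ...   | inj₂ (i′ , i⇝i′ , i′w) = ⊥-elim (reach-false (U ∖ x) w unreached (reverse (z⇝i ++ i⇝w)))
        where
        z⇝i = reach-sound (U ∖ x) z i∈K′
        x≢w = proj₂ (∖-true⁻ U w (K⊆U∖w w y x x∈K))
        outside-K : ∀ j → Path (U ∖ w) i j → not (K w y j) ≡ true
        outside-K j i⇝j with K w y j in j∈K
        ... | false = refl
        ... | true = ⊥-elim (true≢false (trans (sym (reach-complete (U ∖ w) y (reach-sound (U ∖ w) y j∈K ++ reverse i⇝j))) i∈K))
        avoids-x : U ∖ w ─ K w y ⊆ U ∖ x
        avoids-x j e with ∧-true⁻ {(U ∖ w) j} e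
        ... | j∈U∖w , j∉K = ∖-true⁺ U x (∖-⊆ U w j j∈U∖w)
          (λ { refl → true≢false (trans (sym x∈K) (not-true⁻ j∉K)) })
        i⇝w : Path (U ∖ x) i w
        i⇝w = extend (Path-mono avoids-x (Path-∩ (λ j → not (K w y j)) i⇝i′ outside-K)) i′w
          (∖-true⁺ U x Uw (λ w≡x → x≢w (sym w≡x)))

      -- If x ∈ K w y separates w from z, then K x z is strictly inside K w y.
      find-pendant : ∀ m {w y} → U w ≡ true → (U ∖ w) y ≡ true → count (K w y) ≤ m →
        ∃ λ w′ → ∃ λ y′ → U w′ ≡ true × (U ∖ w′) y′ ≡ true × Pendant w′ y′
      find-pendant m {w} {y} Uw y∈ ∣K∣≤m
        with inhabited? (λ x → K w y x ∧ any (λ z → (U ∖ x) z ∧ not (reach (U ∖ x) w z)))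
      ... | inj₂ none = w , y , Uw , y∈ , pendant
        where
        pendant : Pendant w y
        pendant {x} {z} x∈K z∈ with reach (U ∖ x) w z in r
        ... | true = reach-sound (U ∖ x) w r
        ... | false = ⊥-elim (true≢false (trans (sym cut) (none x)))
          where
          cut = ∧-true⁺ x∈K (any-true⁺ (λ z → (U ∖ x) z ∧ not (reach (U ∖ x) w z)) (∧-true⁺ z∈ (not-true⁺ r)))
      ... | inj₁ (x , e) with ∧-true⁻ {K w y x} e
      ... | x∈K , some with any-true⁻ (λ z → (U ∖ x) z ∧ not (reach (U ∖ x) w z)) some | m
      ... | z , e′ | zero = ⊥-elim (<⇒≱ (∈⇒1≤count (K w y) x∈K) ∣K∣≤m)
      ... | z , e′ | suc m with ∧-true⁻ {(U ∖ x) z} e′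
      ... | z∈ , unreached = find-pendant m (∖-⊆ U w x (K⊆U∖w w y x x∈K)) z∈
        (s≤s⁻¹ (≤-trans (count-⊂ (K-shrinks Uw x∈K (not-true⁻ unreached)) x∈K x∉K′) ∣K∣≤m))
        where
        x∉K′ : K x z x ≡ false
        x∉K′ with K x z x in e″
        ... | false = refl
        ... | true = ⊥-elim (proj₂ (∖-true⁻ U x (K⊆U∖w x z x e″)) refl)

      module AtPendant {w y} (Uw : U w ≡ true) (y∈U∖w : (U ∖ w) y ≡ true) (pendant : Pendant w y) where

        P : Sub n
        P = K w y

        P⊆U : P ⊆ U
        P⊆U i e = ∖-⊆ U w i (K⊆U∖w w y i e)

        ∈P⇒≢w : ∀ {i} → P i ≡ true → i ≢ w
        ∈P⇒≢w e = proj₂ (∖-true⁻ U w (K⊆U∖w w y _ e))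

        y∈P : P y ≡ true
        y∈P = reach-complete (U ∖ w) y (here y∈U∖w)

        w∉P : P w ≡ false
        w∉P with P w in e
        ... | true = ⊥-elim (∈P⇒≢w e refl)
        ... | false = refl

        no-edges-into-P : ∀ {u} → U u ≡ true → u ≢ w → P u ≡ false → deg P u ≤ 0
        no-edges-into-P {u} Uu u≢w u∉P = ∉⇒count≤0 (λ j → A u j ∧ P j) none
          where
          none : ∀ j → A u j ∧ P j ≡ false
          none j with A u j in uj | P j in j∈P
          ... | false | _ = refl
          ... | true | false = refl
          ... | true | true = ⊥-elim (true≢false (trans (sym (K-closed j∈P (adj-flip uj) (∖-true⁺ U w Uu u≢w))) u∉P))

        deg≤2 : ∀ {x} → P x ≡ true → deg U x ≤ 2
        deg≤2 {x} x∈P = ≮⇒≥ three-neighbours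
          where
          three-neighbours : 2 < deg U x → ⊥
          three-neighbours 3≤deg with three-elements (λ j → A x j ∧ U j) 3≤deg
          ... | x₁ , x₂ , x₃ , e₁ , e₂ , e₃ , x₁≢x₂ , x₁≢x₃ , x₂≢x₃ =
            cactus⇒no-linked-neighbours cactus (proj₁ (∧-true⁻ e₁)) (proj₁ (∧-true⁻ e₂)) (proj₁ (∧-true⁻ e₃))
              x₁≢x₂ x₁≢x₃ x₂≢x₃ (into-full (reverse (to e₁) ++ to e₂)) (into-full (reverse (to e₁) ++ to e₃))
            where
            to : ∀ {j} → A x j ∧ U j ≡ true → Path (U ∖ x) w j
            to {j} e with ∧-true⁻ {A x j} e
            ... | xj , Uj = pendant x∈P (∖-true⁺ U x Uj (adj⇒≢ xj))
            into-full : ∀ {a b} → Path (U ∖ x) a b → Path (full ∖ x) a b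
            into-full = Path-mono (λ i e → ∧-true⁺ refl (proj₂ (∧-true⁻ {U i} e)))

        module _ (P-within-capacity : ∀ x → P x ≡ true → deg U x ≤ c x) where

          remove-P-lowering-w : deg P w ≤ c w → Deletion U c
          remove-P-lowering-w t≤cw = by-removal removal (P⊆U y y∈P) (∨-trueˡ _ y∈P)
            where
            removal : Removal U c
            removal = record
              { X = P ; Y = ∅ ; p = w ; t = deg P w
              ; X⊆U = P⊆U
              ; Y⊆U = λ _ ()
              ; X∩Y=∅ = λ i → ∧-zeroʳ (P i)
              ; t≤c = t≤cw
              ; X-within-capacity = λ x x∈P →
                  ≤-trans (deg-mono x (λ j _ e → trans (sym (∧-identityʳ (U j))) e)) (P-within-capacity x x∈P)
              ; X-attached-at-p = attached
              ; affordable = begin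
                  deg P w + suc k * count (∅ {n})   ≡⟨ cong (λ m → deg P w + suc k * m) (count-∅ {n}) ⟩
                  deg P w + suc k * 0               ≡⟨ cong (deg P w +_) (*-zeroʳ (suc k)) ⟩
                  deg P w + 0                       ≡⟨ +-identityʳ (deg P w) ⟩
                  deg P w                           ≤⟨ deg≤count P w (λ _ _ e → e) ⟩
                  count P                           ≤⟨ count≤potential P c ⟩
                  potential P c                     ≤⟨ m≤m+n (potential P c) (potential ∅ c) ⟩
                  potential P c + potential ∅ c     ∎
              ; affordable-strictly = inj₁ (w , ∧-true⁺ Uw (not-true⁺ (∨-false⁺ w∉P refl)))
              }
              where
              open ≤-Reasoning
              attached : ∀ u → (U ─ (P ∪ ∅)) u ≡ true → deg P u ≤ (if ⁅ w ⁆ u then deg P w else 0)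
              attached u e with ⁅ w ⁆ u in u≡w | ∧-true⁻ {U u} e
              ... | true | _ = ≤-reflexive (cong (deg P) (∈⁅⁆⇒≡ u≡w))
              ... | false | Uu , u∉P = no-edges-into-P Uu (∉⁅⁆⇒≢ u≡w) (proj₁ (∨-false⁻ {P u} (not-true⁻ u∉P)))

          remove-P-and-w : c w < deg P w → Deletion U c
          remove-P-and-w over = by-removal removal (P⊆U y y∈P) (∨-trueˡ _ y∈P)
            where
            paid-for-w : suc k * count ⁅ w ⁆ ≡ suc k
            paid-for-w = trans (cong (suc k *_) (weight-⁅⁆ w)) (*-identityʳ (suc k))
            available : suc (suc k) ≤ potential P c + potential ⁅ w ⁆ c
            available = begin
              suc (suc k)                              ≤⟨ s≤s (s≤s (m≤n+m∸n k (c w))) ⟩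
              suc (suc (c w + (k ∸ c w)))              ≡⟨ cong suc (+-suc (c w) (k ∸ c w)) ⟨
              suc (c w) + suc (k ∸ c w)                ≤⟨ +-monoˡ-≤ _ (≤-trans over (deg≤count P w (λ _ _ e → e))) ⟩
              count P + suc (k ∸ c w)                  ≤⟨ +-mono-≤ (count≤potential P c) (≤-reflexive (sym (weight-⁅⁆ w))) ⟩
              potential P c + potential ⁅ w ⁆ c        ∎
              where open ≤-Reasoning
            removal : Removal U c
            removal = record
              { X = P ; Y = ⁅ w ⁆ ; p = w ; t = 0
              ; X⊆U = P⊆U
              ; Y⊆U = ⁅⁆⊆ Uw
              ; X∩Y=∅ = separated⇒disjoint {S = P} (λ _ e → e) (λ j j≡w → subst (λ i → P i ≡ false) (sym (∈⁅⁆⇒≡ j≡w)) w∉P)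
              ; t≤c = z≤n
              ; X-within-capacity = λ x x∈P → ≤-trans (deg-mono x (λ j _ e → proj₁ (∧-true⁻ {U j} e))) (P-within-capacity x x∈P)
              ; X-attached-at-p = attached
              ; affordable = ≤-trans (≤-reflexive paid-for-w) (≤-trans (n≤1+n (suc k)) available)
              ; affordable-strictly = inj₂ (≤-trans (s≤s (≤-reflexive paid-for-w)) available)
              }
              where
              attached : ∀ u → (U ─ (P ∪ ⁅ w ⁆)) u ≡ true → deg P u ≤ (if ⁅ w ⁆ u then 0 else 0)
              attached u e with ∧-true⁻ {U u} e
              ... | Uu , u∉P∪w with ∨-false⁻ {P u} (not-true⁻ u∉P∪w)
              ... | u∉P , u≢w = ≤-trans (no-edges-into-P Uu (∉⁅⁆⇒≢ u≢w) u∉P) z≤n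

          remove-P : Deletion U c
          remove-P with deg P w ≤? c w
          ... | yes t≤cw = remove-P-lowering-w t≤cw
          ... | no t≰cw = remove-P-and-w (≰⇒> t≰cw)

        -- If c b < k we delete b (paid by h and b), else we delete a and
        -- set h and b aside (paid by h, b and a).
        module OverCapacity {h a b : Fin n} (h∈P : P h ≡ true) (c-h≡1 : c h ≡ 1)
          (h-a : A h a ≡ true) (h-b : A h b ≡ true) (a≢b : a ≢ b) (Ua : U a ≡ true) (b∈P : P b ≡ true)
          (only : ∀ {j} → A h j ≡ true → U j ≡ true → j ≡ a ⊎ j ≡ b) where

          Uh = P⊆U h h∈P
          Ub = P⊆U b b∈P
          a≢h = adj⇒≢ h-a
          b≢h = adj⇒≢ h-b

          k≤pot-h : k ≤ potential ⁅ h ⁆ c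
          k≤pot-h = begin
            k                        ≤⟨ m≤n+m∸n k 1 ⟩
            suc (k ∸ 1)              ≡⟨ cong (λ m → suc (k ∸ m)) c-h≡1 ⟨
            suc (k ∸ c h)           ≡⟨ weight-⁅⁆ h ⟨
            potential ⁅ h ⁆ c       ∎
            where open ≤-Reasoning

          deg-⁅⁆≤1 : ∀ x u → deg ⁅ x ⁆ u ≤ 1
          deg-⁅⁆≤1 x u = ≤-trans (deg≤count ⁅ x ⁆ u (λ _ _ e → e)) (≤-reflexive (weight-⁅⁆ x))

          single-neighbour-within-capacity : ∀ {S} j → (∀ {i} → A h i ≡ true → S i ≡ true → i ≡ j) → deg S h ≤ c h
          single-neighbour-within-capacity j only-j = begin
            deg _ h       ≤⟨ deg≤count ⁅ j ⁆ h (λ i hi Si → ≡⇒∈⁅⁆ (only-j hi Si)) ⟩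
            count ⁅ j ⁆    ≡⟨ weight-⁅⁆ j ⟩
            1              ≡⟨ c-h≡1 ⟨
            c h           ∎
            where open ≤-Reasoning

          other-neighbour : ∃ λ z → A b z ≡ true × (U ∖ h) z ≡ true
          other-neighbour with reverse (pendant h∈P (∖-true⁺ U h Ub b≢h))
          ... | here _ = ⊥-elim (∈P⇒≢w b∈P refl)
          ... | step _ bz z⇝w = _ , bz , source∈ z⇝w

          z = proj₁ other-neighbour
          b-z = proj₁ (proj₂ other-neighbour)
          Uz = proj₁ (∖-true⁻ U h (proj₂ (proj₂ other-neighbour)))
          z≢h = proj₂ (∖-true⁻ U h (proj₂ (proj₂ other-neighbour)))

          b-only : ∀ {j} → A b j ≡ true → U j ≡ true → j ≡ h ⊎ j ≡ z
          b-only bj Uj = count≤2⇒only (λ j → A b j ∧ U j) (∧-true⁺ (adj-flip h-b) Uh) (∧-true⁺ b-z Uz)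
            (λ h≡z → z≢h (sym h≡z)) (deg≤2 b∈P) _ (∧-true⁺ bj Uj)

          delete-b : c b < k → Deletion U c
          delete-b cb<k = by-removal removal Uh (∨-trueˡ _ (x∈⁅x⁆ h))
            where
            removal : Removal U c
            removal = record
              { X = ⁅ h ⁆ ; Y = ⁅ b ⁆ ; p = a ; t = 1
              ; X⊆U = ⁅⁆⊆ Uh
              ; Y⊆U = ⁅⁆⊆ Ub
              ; X∩Y=∅ = ⁅⁆-disjoint (λ h≡b → b≢h (sym h≡b))
              ; t≤c = positive Ua (∈⇒1≤count (λ j → A a j ∧ U j) (∧-true⁺ (adj-flip h-a) Uh))
              ; X-within-capacity = λ x x≡h → subst (λ v → deg (U ─ ⁅ b ⁆) v ≤ c v) (sym (∈⁅⁆⇒≡ x≡h))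
                  (single-neighbour-within-capacity a not-b)
              ; X-attached-at-p = attached
              ; affordable = begin
                  1 + suc k * count ⁅ b ⁆                 ≡⟨ cong (λ m → 1 + suc k * m) (weight-⁅⁆ b) ⟩
                  1 + suc k * 1                            ≡⟨ cong suc (*-identityʳ (suc k)) ⟩
                  2 + k                                    ≡⟨ +-comm 2 k ⟩
                  k + 2                                    ≤⟨ +-mono-≤ k≤pot-h (s≤s (m<n⇒0<n∸m cb<k)) ⟩
                  potential ⁅ h ⁆ c + suc (k ∸ c b)      ≡⟨ cong (potential ⁅ h ⁆ c +_) (weight-⁅⁆ b) ⟨
                  potential ⁅ h ⁆ c + potential ⁅ b ⁆ c  ∎
              ; affordable-strictly = inj₁ (a , ∧-true⁺ Ua (not-true⁺ (∨-false⁺ (∉⁅⁆ a≢h) (∉⁅⁆ a≢b))))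
              }
              where
              open ≤-Reasoning
              not-b : ∀ {i} → A h i ≡ true → (U ─ ⁅ b ⁆) i ≡ true → i ≡ a
              not-b {i} hi e with ∧-true⁻ {U i} e
              ... | Ui , i≢b with only hi Ui
              ... | inj₁ i≡a = i≡a
              ... | inj₂ i≡b = ⊥-elim (∉⁅⁆⇒≢ (not-true⁻ i≢b) i≡b)
              attached : ∀ u → (U ─ (⁅ h ⁆ ∪ ⁅ b ⁆)) u ≡ true → deg ⁅ h ⁆ u ≤ (if ⁅ a ⁆ u then 1 else 0)
              attached u e with ⁅ a ⁆ u in u≟a | ∧-true⁻ {U u} e
              ... | true | _ = deg-⁅⁆≤1 h u
              ... | false | Uu , u∉X∪Y = ∉⇒count≤0 (λ j → A u j ∧ ⁅ h ⁆ j) none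
                where
                none : ∀ j → A u j ∧ ⁅ h ⁆ j ≡ false
                none j with A u j in uj | ⁅ h ⁆ j in j≟h
                ... | false | _ = refl
                ... | true | false = refl
                ... | true | true with only (subst (λ i → A i u ≡ true) (∈⁅⁆⇒≡ j≟h) (adj-flip uj)) Uu
                ...   | inj₁ u≡a = ⊥-elim (∉⁅⁆⇒≢ u≟a u≡a)
                ...   | inj₂ u≡b = ⊥-elim (true≢false (trans (sym (∨-trueʳ (⁅ h ⁆ u) (≡⇒∈⁅⁆ u≡b))) (not-true⁻ u∉X∪Y)))

          delete-a : k ≤ c b → Deletion U c
          delete-a k≤cb = by-removal removal Uh (∨-trueˡ _ (∨-trueˡ _ (x∈⁅x⁆ h)))
            where
            X : Sub n
            X = ⁅ h ⁆ ∪ ⁅ b ⁆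

            1≤potential-⁅⁆ : ∀ x → 1 ≤ potential ⁅ x ⁆ c
            1≤potential-⁅⁆ x = ≤-trans (s≤s z≤n) (≤-reflexive (sym (weight-⁅⁆ x)))

            paid-for-a : suc k * count ⁅ a ⁆ ≡ suc k
            paid-for-a = trans (cong (suc k *_) (weight-⁅⁆ a)) (*-identityʳ (suc k))

            potential-X : potential X c ≡ potential ⁅ h ⁆ c + potential ⁅ b ⁆ c
            potential-X = weight-disjoint-∪ ⁅ h ⁆ ⁅ b ⁆ (⁅⁆-disjoint (λ h≡b → b≢h (sym h≡b)))

            available : suc (suc k) ≤ potential X c + potential ⁅ a ⁆ c
            available = begin
              suc (suc k)                                                   ≡⟨ +-comm 2 k ⟩
              k + 2                                                         ≤⟨ +-mono-≤ k≤pot-h (+-mono-≤ (1≤potential-⁅⁆ b) (1≤potential-⁅⁆ a)) ⟩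
              potential ⁅ h ⁆ c + (potential ⁅ b ⁆ c + potential ⁅ a ⁆ c) ≡⟨ +-assoc (potential ⁅ h ⁆ c) _ _ ⟨
              potential ⁅ h ⁆ c + potential ⁅ b ⁆ c + potential ⁅ a ⁆ c   ≡⟨ cong (_+ potential ⁅ a ⁆ c) potential-X ⟨
              potential X c + potential ⁅ a ⁆ c                             ∎
              where open ≤-Reasoning

            not-a : ∀ {i} → A h i ≡ true → (U ─ ⁅ a ⁆) i ≡ true → i ≡ b
            not-a {i} hi e with ∧-true⁻ {U i} e
            ... | Ui , i≢a with only hi Ui
            ... | inj₁ i≡a = ⊥-elim (∉⁅⁆⇒≢ (not-true⁻ i≢a) i≡a)
            ... | inj₂ i≡b = i≡b

            X-within-capacity : ∀ x → X x ≡ true → deg (U ─ ⁅ a ⁆) x ≤ c x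
            X-within-capacity x x∈X with ∨-true⁻ {⁅ h ⁆ x} x∈X
            ... | inj₁ x≡h = subst (λ v → deg (U ─ ⁅ a ⁆) v ≤ c v) (sym (∈⁅⁆⇒≡ x≡h)) (single-neighbour-within-capacity b not-a)
            ... | inj₂ x≡b = subst (λ v → deg (U ─ ⁅ a ⁆) v ≤ c v) (sym (∈⁅⁆⇒≡ x≡b)) (begin
              deg (U ─ ⁅ a ⁆) b    ≤⟨ deg-mono b (λ j _ e → proj₁ (∧-true⁻ {U j} e)) ⟩
              deg U b               ≤⟨ deg≤2 b∈P ⟩
              2                      ≤⟨ 2≤k ⟩
              k                      ≤⟨ k≤cb ⟩
              c b                   ∎)
              where open ≤-Reasoning

            X-neighbour : ∀ {u j} → U u ≡ true → u ≢ h → u ≢ b → u ≢ a → A u j ≡ true → X j ≡ true → j ≡ b × u ≡ z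
            X-neighbour {u} {j} Uu u≢h u≢b u≢a uj j∈X with ∨-true⁻ {⁅ h ⁆ j} j∈X
            ... | inj₁ j≡h = ⊥-elim ([ u≢a , u≢b ]′ (only (subst (λ i → A i u ≡ true) (∈⁅⁆⇒≡ j≡h) (adj-flip uj)) Uu))
            ... | inj₂ j≡b = ∈⁅⁆⇒≡ j≡b , [ (λ u≡h → ⊥-elim (u≢h u≡h)) , (λ u≡z → u≡z) ]′
                                              (b-only (subst (λ i → A i u ≡ true) (∈⁅⁆⇒≡ j≡b) (adj-flip uj)) Uu)

            attached : ∀ u → (U ─ (X ∪ ⁅ a ⁆)) u ≡ true → deg X u ≤ (if ⁅ z ⁆ u then 1 else 0)
            attached u e = bound
              where
              Uu = proj₁ (∧-true⁻ {U u} e)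
              u∉X∪Y = ∨-false⁻ {X u} (not-true⁻ (proj₂ (∧-true⁻ {U u} e)))
              u∉X = ∨-false⁻ {⁅ h ⁆ u} (proj₁ u∉X∪Y)
              neighbour : ∀ {j} → A u j ≡ true → X j ≡ true → j ≡ b × u ≡ z
              neighbour = X-neighbour Uu (∉⁅⁆⇒≢ (proj₁ u∉X)) (∉⁅⁆⇒≢ (proj₂ u∉X)) (∉⁅⁆⇒≢ (proj₂ u∉X∪Y))
              bound : deg X u ≤ (if ⁅ z ⁆ u then 1 else 0)
              bound with ⁅ z ⁆ u in u≟z
              ... | true = ≤-trans (deg≤count ⁅ b ⁆ u (λ j uj j∈X → ≡⇒∈⁅⁆ (proj₁ (neighbour uj j∈X)))) (≤-reflexive (weight-⁅⁆ b))
              ... | false = ∉⇒count≤0 (λ j → A u j ∧ X j) none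
                where
                none : ∀ j → A u j ∧ X j ≡ false
                none j with A u j in uj | X j in j∈X
                ... | false | _ = refl
                ... | true | false = refl
                ... | true | true = ⊥-elim (∉⁅⁆⇒≢ u≟z (proj₂ (neighbour uj j∈X)))

            removal : Removal U c
            removal = record
              { X = X ; Y = ⁅ a ⁆ ; p = z ; t = 1
              ; X⊆U = ∪-⊆ (⁅⁆⊆ Uh) (⁅⁆⊆ Ub)
              ; Y⊆U = ⁅⁆⊆ Ua
              ; X∩Y=∅ = separated⇒disjoint {S = X} (λ _ e → e) (λ i i≡a →
                  ∨-false⁺ (∉⁅⁆ {i = i} (λ i≡h → a≢h (trans (sym (∈⁅⁆⇒≡ {i = i} i≡a)) i≡h)))
                           (∉⁅⁆ {i = i} (λ i≡b → a≢b (trans (sym (∈⁅⁆⇒≡ {i = i} i≡a)) i≡b))))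
              ; t≤c = positive Uz (∈⇒1≤count (λ j → A z j ∧ U j) (∧-true⁺ (adj-flip b-z) Ub))
              ; X-within-capacity = X-within-capacity
              ; X-attached-at-p = attached
              ; affordable = ≤-trans (≤-reflexive (cong suc paid-for-a)) available
              ; affordable-strictly = inj₂ (≤-trans (s≤s (≤-reflexive paid-for-a)) available)
              }

          resolve : Deletion U c
          resolve with c b <? k
          ... | yes cb<k = delete-b cb<k
          ... | no cb≮k = delete-a (≮⇒≥ cb≮k)

        over-capacity : ∀ {h} → P h ≡ true → c h < deg U h → Deletion U c
        over-capacity {h} h∈P over = orient (two-elements (λ j → A h j ∧ U j) (≤-trans (s≤s 1≤c-h) over))
          where
          1≤c-h : 1 ≤ c h
          1≤c-h = positive (P⊆U h h∈P) (≤-trans (s≤s z≤n) over)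

          c-h≡1 : c h ≡ 1
          c-h≡1 = ≤-antisym (s≤s⁻¹ (≤-trans over (deg≤2 h∈P))) 1≤c-h

          neighbour∈P : ∀ {j} → A h j ≡ true → U j ≡ true → j ≢ w → P j ≡ true
          neighbour∈P hj Uj j≢w = K-closed h∈P hj (∖-true⁺ U w Uj j≢w)

          only : ∀ {a b} → (A h a ∧ U a) ≡ true → (A h b ∧ U b) ≡ true → a ≢ b →
            ∀ {j} → A h j ≡ true → U j ≡ true → j ≡ a ⊎ j ≡ b
          only e₁ e₂ a≢b hj Uj = count≤2⇒only (λ j → A h j ∧ U j) e₁ e₂ a≢b (deg≤2 h∈P) _ (∧-true⁺ hj Uj)

          orient : (∃ λ a → ∃ λ b → (A h a ∧ U a) ≡ true × (A h b ∧ U b) ≡ true × a ≢ b) → Deletion U c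
          orient (a , b , e₁ , e₂ , a≢b) with ∧-true⁻ {A h a} e₁ | ∧-true⁻ {A h b} e₂ | a ≟ w
          ... | ha , Ua | hb , Ub | yes a≡w =
            OverCapacity.resolve h∈P c-h≡1 ha hb a≢b Ua (neighbour∈P hb Ub (λ b≡w → a≢b (trans a≡w (sym b≡w))))
              (only e₁ e₂ a≢b)
          ... | ha , Ua | hb , Ub | no a≢w =
            OverCapacity.resolve h∈P c-h≡1 hb ha (λ b≡a → a≢b (sym b≡a)) Ub (neighbour∈P ha Ua a≢w)
              (λ hj Uj → swap (only e₁ e₂ a≢b hj Uj))

        resolve : Deletion U c
        resolve with any? (λ x → (P x Bool.≟ true) ×-dec (c x <? deg U x))
        ... | yes (h , h∈P , over) = over-capacity h∈P over
        ... | no none = remove-P (λ x x∈P → ≮⇒≥ (λ over → none (x , x∈P , over)))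

      resolve : ∀ {h} → U h ≡ true → c h < deg U h → Deletion U c
      resolve {h} Uh over with 1≤count⇒∃ (λ j → A h j ∧ U j) (≤-trans (s≤s z≤n) over)
      ... | y , e with ∧-true⁻ {A h y} e
      ... | hy , Uy with find-pendant n Uh (∖-true⁺ U h Uy (adj⇒≢ hy)) (count≤n (K h y))
      ... | w , y′ , Uw , y′∈ , pendant = AtPendant.resolve Uw y′∈ pendant

    resolve : Deletion U c
    resolve with any? (λ v → (U v Bool.≟ true) ×-dec (c v <? deg U v))
    ... | no none = no-deletion (λ v Uv → ≮⇒≥ (λ over → none (v , Uv , over)))
    ... | yes (h , Uh , over) with inhabited? (U ─ reach U h)
    ...   | inj₁ (x , x∈U─C) = split-off-component Uh x∈U─C
    ...   | inj₂ all-reached with any? (λ v → (U v Bool.≟ true) ×-dec ((c v ℕ.≟ 0) ×-dec (1 ≤? deg U v)))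
    ...     | yes (v , Uv , cv≡0 , has-neighbour) = delete-zero-capacity Uv cv≡0 has-neighbour
    ...     | no none = Connected.resolve linked positive Uh over
      where
      from-h : ∀ {a} → U a ≡ true → Path U h a
      from-h {a} Ua with reach U h a in r
      ... | true = reach-sound U h r
      ... | false = ⊥-elim (true≢false (trans (sym (∧-true⁺ Ua (not-true⁺ r))) (all-reached a)))
      linked : Linked U
      linked Ua Ub = reverse (from-h Ua) ++ from-h Ub
      positive : ∀ {v} → U v ≡ true → 1 ≤ deg U v → 1 ≤ c v
      positive {v} Uv has-neighbour with c v in cv
      ... | suc _ = s≤s z≤n
      ... | zero = ⊥-elim (none (v , Uv , cv , has-neighbour))

  deletion : ∀ U c → Deletion U c
  deletion U c = go (count U) U c ≤-refl
    where
    go : ∀ m U c → count U ≤ m → Deletion U c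
    go zero U c ∣U∣≤0 = no-deletion (λ v Uv → ⊥-elim (true≢false (trans (sym Uv) (count≤0⇒∉ U ∣U∣≤0 v))))
    go (suc m) U c ∣U∣≤m = Step.resolve (λ c′ smaller → go m _ c′ (s≤s⁻¹ (≤-trans smaller ∣U∣≤m)))

quotient-bound : ∀ k n d → suc k * d < n → (k * n) / suc k + 1 ≤ n ∸ d
quotient-bound k n d [k+1]d<n = ≤-trans (≤-reflexive (+-comm _ 1)) (m<n*o⇒m/o<n {k * n} {n ∸ d} {suc k} kn<[n∸d][k+1])
  where
  d≤n : d ≤ n
  d≤n = ≤-trans (m≤n*m d (suc k)) (≤-trans (n≤1+n _) [k+1]d<n)
  kd<n∸d : k * d < n ∸ d
  kd<n∸d = +-cancelʳ-< d (k * d) (n ∸ d) (subst₂ _<_ (+-comm d (k * d)) (sym (m∸n+n≡m d≤n)) [k+1]d<n)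
  kn<[n∸d][k+1] : k * n < (n ∸ d) * suc k
  kn<[n∸d][k+1] = begin-strict
    k * n                        ≡⟨ cong (k *_) (m∸n+n≡m d≤n) ⟨
    k * (n ∸ d + d)              ≡⟨ *-distribˡ-+ k (n ∸ d) d ⟩
    k * (n ∸ d) + k * d          <⟨ +-monoʳ-< (k * (n ∸ d)) kd<n∸d ⟩
    k * (n ∸ d) + (n ∸ d)        ≡⟨ +-comm (k * (n ∸ d)) (n ∸ d) ⟩
    suc k * (n ∸ d)              ≡⟨ *-comm (suc k) (n ∸ d) ⟩
    (n ∸ d) * suc k              ∎
    where open ≤-Reasoning

module Complement {n : ℕ} (G : Graph n) (k : ℕ) (del : Deletions.Deletion G k full (λ _ → k)) where
  open Paths G
  open Deletions G k
  open Deletion del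

  S : Subset n
  S = tabulate (full ─ D)

  ∣D∣ : ℕ
  ∣D∣ = count D

  lookup-S : ∀ v → lookup S v ≡ not (D v)
  lookup-S = lookup∘tabulate (full ─ D)

  sparse : Sparse G k S
  sparse v v∈S = begin
    degIn G S v                          ≡⟨ ∣tabulate∣≡count (λ w → A v w ∧ lookup S w) ⟩
    count (λ w → A v w ∧ lookup S w)     ≡⟨ weight-cong (λ w → cong (A v w ∧_) (lookup-S w)) ⟩
    deg (full ─ D) v                     ≤⟨ within-capacity v refl (not-true⁻ (trans (sym (lookup-S v)) ([]=⇒lookup v∈S))) ⟩
    k                                    ∎
    where open ≤-Reasoning

  ∣S∣≡n∸∣D∣ : ∣ S ∣ ≡ n ∸ ∣D∣
  ∣S∣≡n∸∣D∣ = begin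
    ∣ S ∣                                ≡⟨ ∣tabulate∣≡count (full ─ D) ⟩
    count (full ─ D)                     ≡⟨ m+n∸m≡n ∣D∣ (count (full ─ D)) ⟨
    ∣D∣ + count (full ─ D) ∸ ∣D∣         ≡⟨ cong (_∸ ∣D∣) (trans (sym count-full) (weight-∩-─ full D)) ⟨
    n ∸ ∣D∣                              ∎
    where open ≡-Reasoning

  cost<n : Fin n → suc k * ∣D∣ < n
  cost<n x = subst (suc k * ∣D∣ <_) potential-full (cost-strict {x} refl)
    where
    potential-full : potential full (λ _ → k) ≡ n
    potential-full = trans (∑-cong {n} (λ _ → cong suc (n∸n≡0 k))) (count-full {n})

lemma4p4 : (k : ℕ) → 2 ≤ k → (n : ℕ) → 1 ≤ n → (G : Graph n) → Cactus G →
    αk≥ G k ((k * n) / suc k + 1)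
lemma4p4 k 2≤k n 1≤n G cactus = S , sparse , (begin
    (k * n) / suc k + 1    ≤⟨ quotient-bound k n ∣D∣ (cost<n (fromℕ< 1≤n)) ⟩
    n ∸ ∣D∣                ≡⟨ ∣S∣≡n∸∣D∣ ⟨
    ∣ S ∣                  ∎)
  where
  open Complement G k (CactusDeletions.deletion G k 2≤k cactus full (λ _ → k))
  open ≤-Reasoning
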